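{- Let $q$ be a prime power, $n\ge1$, and let $A,L,M\in\mathbb{F}_{q^n}[x]$ be $q$-additive polynomials. Suppose that $A$ and $L$ are separable, monic, of degree $>2$ and split over $\mathbb{F}_{q^n}$, and that $L=\gamma A(M(x))$ for some $\gamma\in\mathbb{F}_{q^n}^*$. Then the map $\phi_M:\mathcal W(L\mid\mathbb{F}_{q^n})\to\mathcal W(A\mid\mathbb{F}_{q^n})$ given by $\phi_M(F)=M(F)$ is $\mathbb{F}_q$-linear with kernel $\mathcal R(M)$.
   Context: A $q$-additive polynomial is one of the form $\sum_{i=0}^m\omega_i x^{q^i}$ with coefficients in $\mathbb{F}_{q^n}$. $\mathcal R(M)$ is the set of roots of $M$ (viewed as constant polynomials). For a separable monic polynomial $T$ of degree $>2$ splitting over $\mathbb{F}_{q^n}$, $\mathcal W(T\mid\mathbb{F}_{q^n}):=\{F\in\mathbb{F}_{q^n}[x]: T(F)=\theta(x^{q^n}-x)F' \text{ for some }\theta\in\mathbb{F}_{q^n}^*\}$; for $T$ $q$-additive this is an $\mathbb{F}_q$-vector space. -}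

module Defs where

open import Level using (_⊔_)
open import Algebra.Bundles using (CommutativeRing)
open import Data.Nat as ℕ using (ℕ; zero; suc; _^_)
open import Data.Nat.Primality using (Prime)
open import Data.List using (List; []; _∷_; length; foldr; map)
open import Data.List.Relation.Unary.Any using (Any)
open import Data.List.Relation.Unary.AllPairs using (AllPairs)
open import Data.Product using (Σ; ∃; ∃₂; _×_; _,_)
open import Relation.Binary.PropositionalEquality using (_≡_)
open import Relation.Nullary using (¬_)

PrimePower : ℕ → Set
PrimePower q = ∃₂ λ p k → Prime p × q ≡ p ^ suc k

-- A commutative ring R which is a field with exactly N elements
-- (so R is "the" finite field F_N, unique up to isomorphism).
record IsFiniteFieldOfSize {c ℓ} (R : CommutativeRing c ℓ) (N : ℕ) : Set (c ⊔ ℓ) where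
  open CommutativeRing R
  field
    nontrivial : ¬ (1# ≈ 0#)
    inverse    : ∀ a → ¬ (a ≈ 0#) → ∃ λ b → a * b ≈ 1#
    elems      : List Carrier
    elems-size : length elems ≡ N
    elems-dist : AllPairs (λ a b → ¬ (a ≈ b)) elems
    elems-all  : ∀ a → Any (a ≈_) elems

-- Univariate polynomials over R (coefficient lists, lowest degree first),
-- with q and n fixed (the base field F_q inside K = F_{q^n}).
module Poly {c ℓ} (R : CommutativeRing c ℓ) (q n : ℕ) where
  open CommutativeRing R public renaming (Carrier to K)

  Pol : Set c
  Pol = List K

  coeff : Pol → ℕ → K
  coeff [] _ = 0#
  coeff (a ∷ p) zero = a
  coeff (a ∷ p) (suc i) = coeff p i

  infix 4 _≈ₚ_
  _≈ₚ_ : Pol → Pol → Set ℓ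
  p ≈ₚ r = ∀ i → coeff p i ≈ coeff r i

  0ₚ : Pol
  0ₚ = []

  1ₚ : Pol
  1ₚ = 1# ∷ []

  constₚ : K → Pol
  constₚ a = a ∷ []

  infixl 6 _+ₚ_
  _+ₚ_ : Pol → Pol → Pol
  [] +ₚ r = r
  (a ∷ p) +ₚ [] = a ∷ p
  (a ∷ p) +ₚ (b ∷ r) = (a + b) ∷ (p +ₚ r)

  -ₚ_ : Pol → Pol
  -ₚ p = map (-_) p

  infixr 7 _·ₚ_
  _·ₚ_ : K → Pol → Pol
  a ·ₚ p = map (a *_) p

  infixl 7 _*ₚ_
  _*ₚ_ : Pol → Pol → Pol
  [] *ₚ r = []
  (a ∷ p) *ₚ r = (a ·ₚ r) +ₚ (0# ∷ (p *ₚ r))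

  X : Pol
  X = 0# ∷ 1# ∷ []

  Xpow : ℕ → Pol
  Xpow zero = 1ₚ
  Xpow (suc k) = 0# ∷ Xpow k

  infixr 9 _∘ₚ_
  _∘ₚ_ : Pol → Pol → Pol
  [] ∘ₚ m = []
  (a ∷ p) ∘ₚ m = constₚ a +ₚ (m *ₚ (p ∘ₚ m))

  eval : Pol → K → K
  eval p a = foldr (λ b acc → b + a * acc) 0# p

  natMul : ℕ → K → K
  natMul zero a = 0#
  natMul (suc k) a = a + natMul k a

  powK : K → ℕ → K
  powK a zero = 1#
  powK a (suc k) = a * powK a k

  derivFrom : ℕ → Pol → Pol
  derivFrom k [] = []
  derivFrom k (a ∷ p) = natMul k a ∷ derivFrom (suc k) p

  deriv : Pol → Pol
  deriv [] = []
  deriv (a ∷ p) = derivFrom 1 p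

  qPolyFrom : ℕ → List K → Pol
  qPolyFrom k [] = []
  qPolyFrom k (w ∷ ω) = (w ·ₚ Xpow (q ^ k)) +ₚ qPolyFrom (suc k) ω

  IsQAdditive : Pol → Set (c ⊔ ℓ)
  IsQAdditive P = ∃ λ ω → P ≈ₚ qPolyFrom 0 ω

  MonicOfDegree : Pol → ℕ → Set ℓ
  MonicOfDegree P d = coeff P d ≈ 1# × (∀ i → d ℕ.< i → coeff P i ≈ 0#)

  Separable : Pol → Set (c ⊔ ℓ)
  Separable P = ∃₂ λ u v → (u *ₚ P) +ₚ (v *ₚ deriv P) ≈ₚ 1ₚ

  prodLin : List K → Pol
  prodLin rs = foldr (λ r acc → ((- r) ∷ 1# ∷ []) *ₚ acc) 1ₚ rs

  Splits : Pol → Set (c ⊔ ℓ)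
  Splits P = ∃₂ λ a rs → P ≈ₚ a ·ₚ prodLin rs

  -- F_q inside K = F_{q^n}: elements with a^q = a
  InFq : K → Set ℓ
  InFq a = powK a q ≈ a

  W : Pol → Pol → Set (c ⊔ ℓ)
  W T F = ∃ λ θ → ¬ (θ ≈ 0#) × (T ∘ₚ F ≈ₚ θ ·ₚ ((Xpow (q ^ n) +ₚ (-ₚ X)) *ₚ deriv F))

  NiceQAdditive : Pol → Set (c ⊔ ℓ)
  NiceQAdditive P = IsQAdditive P × Separable P
                  × (∃ λ d → 2 ℕ.< d × MonicOfDegree P d) × Splits P

-- Write M = μ x + (terms in x^(q^j), j ≥ 1).  In characteristic p, with q a power of p, the
-- derivative of M is the constant μ, so by the chain rule (M ∘ F)′ = μ F′; and μ ≠ 0, since otherwise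
-- L′ = γ (A′ ∘ M) M′ = 0, impossible for the separable L, which has a root.  Hence if
-- L(F) = θ (x^(q^n) − x) F′ then A(M(F)) = γ⁻¹ θ μ⁻¹ (x^(q^n) − x) (M ∘ F)′, i.e. M(F) ∈ W(A).
-- F_q-linearity of F ↦ M(F) is the Frobenius identity (f + g)^(q^j) = f^(q^j) + g^(q^j) together
-- with a^(q^j) = a for a ∈ F_q.  If moreover M(F) = 0 then F′ = 0, so L(F) = 0, and since L splits
-- into linear factors over a field, F is a constant root of M; conversely a constant root of M lies
-- in W(L) because A(0) = 0.
module Submission where

open import Defs
open import Level using (Level)
open import Algebra.Bundles using (Semiring; CommutativeRing; CommutativeSemiring; CommutativeMonoid)
open import Data.Nat as ℕ using (ℕ; zero; suc; _≤_; _<_; _∸_; _^_; _!; z≤n; s≤s; NonZero)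
import Data.Nat.Properties as ℕₚ
open import Data.Nat.Properties using (_!*_!≢0)
open import Data.Nat.Divisibility using (_∣_; _∤_; divides; ∣1⇒≡1; ∣⇒≤; m∣m*n)
open import Data.Nat.Primality using (Prime; euclidsLemma; prime⇒nonZero; prime⇒nonTrivial)
open import Data.Nat.DivMod using (m*[n/m]≡n)
open import Data.Nat.Combinatorics using (_C_; k![n∸k]!∣n!; nCn≡1; nCk≡nC[n∸k])
open import Data.Nat.Combinatorics.Specification using (nCk≡n!/k![n-k]!)
open import Data.Fin as Fin using (fromℕ)
open import Data.Fin.Properties using (toℕ<n; toℕ-inject₁; toℕ-fromℕ)
open import Data.Vec.Functional using (tail; init)
open import Data.List using (List; []; _∷_; length; map; foldr)
import Data.List.Properties as Listₚ
open import Data.List.Relation.Unary.Any using (Any; here; there)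
open import Data.List.Relation.Unary.All as All using (All; []; _∷_)
open import Data.List.Relation.Unary.AllPairs as AllPairs using (AllPairs; []; _∷_)
import Data.List.Relation.Unary.AllPairs.Properties as AllPairsₚ
open import Data.Product using (∃; _,_; proj₁; proj₂)
open import Data.Sum using (_⊎_; inj₁; inj₂; [_,_]′)
open import Data.Empty using (⊥-elim)
open import Function using (_∘_; id)
open import Function.Bundles using (_⇔_; mk⇔)
open import Relation.Nullary using (¬_; Dec; yes; no)
open import Relation.Binary.Bundles using (Setoid)
open import Relation.Binary.PropositionalEquality as ≡ using (_≡_; _≢_)
import Relation.Binary.Reasoning.Setoid as SetoidReasoning
import Algebra.Properties.Ring as RingProperties
import Algebra.Properties.Semiring.Mult as SemiringMult
import Algebra.Properties.CommutativeMonoid.Mult as CommutativeMonoidMult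
import Algebra.Properties.Semiring.Exp as SemiringExp
import Algebra.Properties.CommutativeSemiring.Exp as CommutativeSemiringExp
import Algebra.Solver.Ring.NaturalCoefficients.Default as NaturalCoefficientsSolver

module SemiringMultiples {a ℓ} (S : Semiring a ℓ) where
  open Semiring S
  open SemiringMult S using (_×_)

  ×-zeroʳ : ∀ k → k × 0# ≈ 0#
  ×-zeroʳ zero = refl
  ×-zeroʳ (suc k) = trans (+-identityˡ _) (×-zeroʳ k)

module PolynomialRing {c ℓ} (R : CommutativeRing c ℓ) (q n : ℕ) where
  open Poly R q n hiding (zero)
  open SemiringMult semiring using (_×_; ×-congʳ; ×-homo-+; ×-comm-*)
  open CommutativeMonoidMult +-commutativeMonoid using (×-distrib-+)
  open RingProperties ring using (-0#≈0#)
  open SemiringMultiples semiring using (×-zeroʳ)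
  module Scalar = NaturalCoefficientsSolver commutativeSemiring

  -- Wrapping _≈ₚ_ (a Π-type) in a record keeps its arguments inferable.
  infix 4 _≋_
  record _≋_ (p r : Pol) : Set ℓ where
    constructor mk≋
    field coeff≈ : p ≈ₚ r
  open _≋_ public

  ≋-refl : ∀ {p} → p ≋ p
  ≋-refl = mk≋ λ _ → refl

  ≋-sym : ∀ {p r} → p ≋ r → r ≋ p
  ≋-sym e = mk≋ λ i → sym (coeff≈ e i)

  ≋-trans : ∀ {p r s} → p ≋ r → r ≋ s → p ≋ s
  ≋-trans e f = mk≋ λ i → trans (coeff≈ e i) (coeff≈ f i)

  ≋-setoid : Setoid c ℓ
  ≋-setoid = record
    { Carrier = Pol ; _≈_ = _≋_
    ; isEquivalence = record { refl = ≋-refl ; sym = ≋-sym ; trans = ≋-trans } }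

  ∷-cong : ∀ {a b p r} → a ≈ b → p ≋ r → (a ∷ p) ≋ (b ∷ r)
  ∷-cong a≈b p≋r = mk≋ λ { zero → a≈b ; (suc i) → coeff≈ p≋r i }

  ∷-tail : ∀ {a b p r} → (a ∷ p) ≋ (b ∷ r) → p ≋ r
  ∷-tail e = mk≋ λ i → coeff≈ e (suc i)

  ∷≋0ₚ : ∀ {a p} → a ≈ 0# → p ≋ 0ₚ → (a ∷ p) ≋ 0ₚ
  ∷≋0ₚ a≈0 p≋0 = mk≋ λ { zero → a≈0 ; (suc i) → coeff≈ p≋0 i }

  ∷≋0ₚ-tail : ∀ {a p} → (a ∷ p) ≋ 0ₚ → p ≋ 0ₚ
  ∷≋0ₚ-tail e = mk≋ λ i → coeff≈ e (suc i)

  coeff-+ₚ : ∀ p r i → coeff (p +ₚ r) i ≈ coeff p i + coeff r i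
  coeff-+ₚ [] r i = sym (+-identityˡ _)
  coeff-+ₚ (a ∷ p) [] i = sym (+-identityʳ _)
  coeff-+ₚ (a ∷ p) (b ∷ r) zero = refl
  coeff-+ₚ (a ∷ p) (b ∷ r) (suc i) = coeff-+ₚ p r i

  coeff-·ₚ : ∀ a p i → coeff (a ·ₚ p) i ≈ a * coeff p i
  coeff-·ₚ a [] i = sym (zeroʳ a)
  coeff-·ₚ a (b ∷ p) zero = refl
  coeff-·ₚ a (b ∷ p) (suc i) = coeff-·ₚ a p i

  coeff--ₚ : ∀ p i → coeff (-ₚ p) i ≈ - coeff p i
  coeff--ₚ [] i = sym -0#≈0#
  coeff--ₚ (b ∷ p) zero = refl
  coeff--ₚ (b ∷ p) (suc i) = coeff--ₚ p i

  +ₚ-cong : ∀ {p p′ r r′} → p ≋ p′ → r ≋ r′ → p +ₚ r ≋ p′ +ₚ r′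
  +ₚ-cong {p} {p′} {r} {r′} e f = mk≋ λ i →
    trans (coeff-+ₚ p r i) (trans (+-cong (coeff≈ e i) (coeff≈ f i)) (sym (coeff-+ₚ p′ r′ i)))

  ·ₚ-cong : ∀ {a b p r} → a ≈ b → p ≋ r → a ·ₚ p ≋ b ·ₚ r
  ·ₚ-cong {a} {b} {p} {r} e f = mk≋ λ i →
    trans (coeff-·ₚ a p i) (trans (*-cong e (coeff≈ f i)) (sym (coeff-·ₚ b r i)))

  -ₚ-cong : ∀ {p r} → p ≋ r → -ₚ p ≋ -ₚ r
  -ₚ-cong {p} {r} e = mk≋ λ i →
    trans (coeff--ₚ p i) (trans (-‿cong (coeff≈ e i)) (sym (coeff--ₚ r i)))

  +ₚ-assoc : ∀ p r s → (p +ₚ r) +ₚ s ≋ p +ₚ (r +ₚ s)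
  +ₚ-assoc p r s = mk≋ λ i → begin
    coeff ((p +ₚ r) +ₚ s) i              ≈⟨ trans (coeff-+ₚ (p +ₚ r) s i) (+-congʳ (coeff-+ₚ p r i)) ⟩
    (coeff p i + coeff r i) + coeff s i  ≈⟨ +-assoc _ _ _ ⟩
    coeff p i + (coeff r i + coeff s i)  ≈⟨ trans (coeff-+ₚ p (r +ₚ s) i) (+-congˡ (coeff-+ₚ r s i)) ⟨
    coeff (p +ₚ (r +ₚ s)) i              ∎
    where open SetoidReasoning setoid

  +ₚ-comm : ∀ p r → p +ₚ r ≋ r +ₚ p
  +ₚ-comm p r = mk≋ λ i → trans (coeff-+ₚ p r i) (trans (+-comm _ _) (sym (coeff-+ₚ r p i)))

  +ₚ-identityʳ : ∀ p → p +ₚ 0ₚ ≋ p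
  +ₚ-identityʳ p = mk≋ λ i → trans (coeff-+ₚ p [] i) (+-identityʳ _)

  +ₚ-inverseˡ : ∀ p → (-ₚ p) +ₚ p ≋ 0ₚ
  +ₚ-inverseˡ p = mk≋ λ i → trans (coeff-+ₚ (-ₚ p) p i) (trans (+-congʳ (coeff--ₚ p i)) (-‿inverseˡ _))

  ·ₚ-zeroˡ : ∀ {a} p → a ≈ 0# → a ·ₚ p ≋ 0ₚ
  ·ₚ-zeroˡ {a} p a≈0 = mk≋ λ i → trans (coeff-·ₚ a p i) (trans (*-congʳ a≈0) (zeroˡ _))

  ·ₚ-zeroʳ : ∀ a {p} → p ≋ 0ₚ → a ·ₚ p ≋ 0ₚ
  ·ₚ-zeroʳ a {p} p≋0 = mk≋ λ i → trans (coeff-·ₚ a p i) (trans (*-congˡ (coeff≈ p≋0 i)) (zeroʳ _))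

  ·ₚ-distribˡ : ∀ a p r → a ·ₚ (p +ₚ r) ≋ a ·ₚ p +ₚ a ·ₚ r
  ·ₚ-distribˡ a p r = mk≋ λ i → begin
    coeff (a ·ₚ (p +ₚ r)) i            ≈⟨ trans (coeff-·ₚ a (p +ₚ r) i) (*-congˡ (coeff-+ₚ p r i)) ⟩
    a * (coeff p i + coeff r i)        ≈⟨ distribˡ _ _ _ ⟩
    a * coeff p i + a * coeff r i
      ≈⟨ trans (coeff-+ₚ (a ·ₚ p) (a ·ₚ r) i) (+-cong (coeff-·ₚ a p i) (coeff-·ₚ a r i)) ⟨
    coeff (a ·ₚ p +ₚ a ·ₚ r) i         ∎
    where open SetoidReasoning setoid

  ·ₚ-distribʳ : ∀ a b p → (a + b) ·ₚ p ≋ a ·ₚ p +ₚ b ·ₚ p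
  ·ₚ-distribʳ a b p = mk≋ λ i → begin
    coeff ((a + b) ·ₚ p) i             ≈⟨ coeff-·ₚ (a + b) p i ⟩
    (a + b) * coeff p i                ≈⟨ distribʳ _ _ _ ⟩
    a * coeff p i + b * coeff p i
      ≈⟨ trans (coeff-+ₚ (a ·ₚ p) (b ·ₚ p) i) (+-cong (coeff-·ₚ a p i) (coeff-·ₚ b p i)) ⟨
    coeff (a ·ₚ p +ₚ b ·ₚ p) i         ∎
    where open SetoidReasoning setoid

  ·ₚ-assoc : ∀ a b p → a ·ₚ (b ·ₚ p) ≋ (a * b) ·ₚ p
  ·ₚ-assoc a b p = mk≋ λ i →
    trans (coeff-·ₚ a (b ·ₚ p) i) (trans (*-congˡ (coeff-·ₚ b p i))
      (trans (sym (*-assoc _ _ _)) (sym (coeff-·ₚ (a * b) p i))))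

  ·ₚ-identityˡ : ∀ p → 1# ·ₚ p ≋ p
  ·ₚ-identityˡ p = mk≋ λ i → trans (coeff-·ₚ 1# p i) (*-identityˡ _)

  +ₚ-interchange : ∀ a b c d → (a +ₚ b) +ₚ (c +ₚ d) ≋ (a +ₚ c) +ₚ (b +ₚ d)
  +ₚ-interchange a b c d = mk≋ λ i → begin
    coeff ((a +ₚ b) +ₚ (c +ₚ d)) i
      ≈⟨ trans (coeff-+ₚ (a +ₚ b) (c +ₚ d) i) (+-cong (coeff-+ₚ a b i) (coeff-+ₚ c d i)) ⟩
    (coeff a i + coeff b i) + (coeff c i + coeff d i)
      ≈⟨ Scalar.solve 4 (λ x y z w → (x :+ y) :+ (z :+ w) := (x :+ z) :+ (y :+ w)) refl
           (coeff a i) (coeff b i) (coeff c i) (coeff d i) ⟩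
    (coeff a i + coeff c i) + (coeff b i + coeff d i)
      ≈⟨ trans (coeff-+ₚ (a +ₚ c) (b +ₚ d) i) (+-cong (coeff-+ₚ a c i) (coeff-+ₚ b d i)) ⟨
    coeff ((a +ₚ c) +ₚ (b +ₚ d)) i ∎
    where open SetoidReasoning setoid
          open Scalar using (_:+_; _:=_)

  *ₚ-zeroˡ : ∀ {p} r → p ≋ 0ₚ → p *ₚ r ≋ 0ₚ
  *ₚ-zeroˡ {[]} r e = ≋-refl
  *ₚ-zeroˡ {a ∷ p} r e =
    +ₚ-cong (·ₚ-zeroˡ r (coeff≈ e zero)) (∷≋0ₚ refl (*ₚ-zeroˡ r (∷≋0ₚ-tail e)))

  *ₚ-zeroʳ : ∀ p → p *ₚ 0ₚ ≋ 0ₚ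
  *ₚ-zeroʳ [] = ≋-refl
  *ₚ-zeroʳ (a ∷ p) = ∷≋0ₚ refl (*ₚ-zeroʳ p)

  *ₚ-congˡ : ∀ {p p′} r → p ≋ p′ → p *ₚ r ≋ p′ *ₚ r
  *ₚ-congˡ {[]} {[]} r e = ≋-refl
  *ₚ-congˡ {[]} {b ∷ p′} r e = ≋-sym (*ₚ-zeroˡ r (≋-sym e))
  *ₚ-congˡ {a ∷ p} {[]} r e = *ₚ-zeroˡ r e
  *ₚ-congˡ {a ∷ p} {b ∷ p′} r e =
    +ₚ-cong (·ₚ-cong (coeff≈ e zero) ≋-refl) (∷-cong refl (*ₚ-congˡ r (∷-tail e)))

  *ₚ-congʳ : ∀ p {r r′} → r ≋ r′ → p *ₚ r ≋ p *ₚ r′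
  *ₚ-congʳ [] e = ≋-refl
  *ₚ-congʳ (a ∷ p) e = +ₚ-cong (·ₚ-cong refl e) (∷-cong refl (*ₚ-congʳ p e))

  *ₚ-cong : ∀ {p p′ r r′} → p ≋ p′ → r ≋ r′ → p *ₚ r ≋ p′ *ₚ r′
  *ₚ-cong {p′ = p′} {r} e f = ≋-trans (*ₚ-congˡ r e) (*ₚ-congʳ p′ f)

  *ₚ-distribʳ : ∀ r x y → (x +ₚ y) *ₚ r ≋ x *ₚ r +ₚ y *ₚ r
  *ₚ-distribʳ r [] y = ≋-refl
  *ₚ-distribʳ r (a ∷ x) [] = ≋-sym (+ₚ-identityʳ _)
  *ₚ-distribʳ r (a ∷ x) (b ∷ y) = begin
    (a + b) ·ₚ r +ₚ (0# ∷ (x +ₚ y) *ₚ r)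
      ≈⟨ +ₚ-cong (·ₚ-distribʳ a b r) (∷-cong (sym (+-identityˡ 0#)) (*ₚ-distribʳ r x y)) ⟩
    (a ·ₚ r +ₚ b ·ₚ r) +ₚ ((0# ∷ x *ₚ r) +ₚ (0# ∷ y *ₚ r))
      ≈⟨ +ₚ-interchange (a ·ₚ r) (b ·ₚ r) (0# ∷ x *ₚ r) (0# ∷ y *ₚ r) ⟩
    (a ·ₚ r +ₚ (0# ∷ x *ₚ r)) +ₚ (b ·ₚ r +ₚ (0# ∷ y *ₚ r)) ∎
    where open SetoidReasoning ≋-setoid

  *ₚ-identityˡ : ∀ r → 1ₚ *ₚ r ≋ r
  *ₚ-identityˡ r = ≋-trans (+ₚ-cong (·ₚ-identityˡ r) (∷≋0ₚ refl ≋-refl)) (+ₚ-identityʳ r)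

  ·ₚ-*ₚ-assoc : ∀ a p r → (a ·ₚ p) *ₚ r ≋ a ·ₚ (p *ₚ r)
  ·ₚ-*ₚ-assoc a [] r = ≋-refl
  ·ₚ-*ₚ-assoc a (b ∷ p) r = begin
    (a * b) ·ₚ r +ₚ (0# ∷ (a ·ₚ p) *ₚ r)
      ≈⟨ +ₚ-cong (≋-sym (·ₚ-assoc a b r)) (∷-cong (sym (zeroʳ a)) (·ₚ-*ₚ-assoc a p r)) ⟩
    a ·ₚ (b ·ₚ r) +ₚ a ·ₚ (0# ∷ p *ₚ r)
      ≈⟨ ·ₚ-distribˡ a (b ·ₚ r) (0# ∷ p *ₚ r) ⟨
    a ·ₚ (b ·ₚ r +ₚ (0# ∷ p *ₚ r)) ∎
    where open SetoidReasoning ≋-setoid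

  0∷-*ₚ : ∀ p r → (0# ∷ p) *ₚ r ≋ 0# ∷ p *ₚ r
  0∷-*ₚ p r = +ₚ-cong (·ₚ-zeroˡ r refl) ≋-refl

  *ₚ-assoc : ∀ p r s → (p *ₚ r) *ₚ s ≋ p *ₚ (r *ₚ s)
  *ₚ-assoc [] r s = ≋-refl
  *ₚ-assoc (a ∷ p) r s = begin
    (a ·ₚ r +ₚ (0# ∷ p *ₚ r)) *ₚ s        ≈⟨ *ₚ-distribʳ s (a ·ₚ r) _ ⟩
    (a ·ₚ r) *ₚ s +ₚ (0# ∷ p *ₚ r) *ₚ s   ≈⟨ +ₚ-cong (·ₚ-*ₚ-assoc a r s) (0∷-*ₚ (p *ₚ r) s) ⟩
    a ·ₚ (r *ₚ s) +ₚ (0# ∷ (p *ₚ r) *ₚ s) ≈⟨ +ₚ-cong ≋-refl (∷-cong refl (*ₚ-assoc p r s)) ⟩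
    a ·ₚ (r *ₚ s) +ₚ (0# ∷ p *ₚ (r *ₚ s)) ∎
    where open SetoidReasoning ≋-setoid

  *ₚ-∷ʳ : ∀ p b r → p *ₚ (b ∷ r) ≋ b ·ₚ p +ₚ (0# ∷ p *ₚ r)
  *ₚ-∷ʳ [] b r = ≋-sym (∷≋0ₚ refl ≋-refl)
  *ₚ-∷ʳ (a ∷ p) b r = ∷-cong (+-congʳ (*-comm a b)) (begin
    a ·ₚ r +ₚ p *ₚ (b ∷ r)                  ≈⟨ +ₚ-cong ≋-refl (*ₚ-∷ʳ p b r) ⟩
    a ·ₚ r +ₚ (b ·ₚ p +ₚ pr)               ≈⟨ +ₚ-assoc (a ·ₚ r) (b ·ₚ p) pr ⟨
    (a ·ₚ r +ₚ b ·ₚ p) +ₚ pr               ≈⟨ +ₚ-cong (+ₚ-comm (a ·ₚ r) (b ·ₚ p)) ≋-refl ⟩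
    (b ·ₚ p +ₚ a ·ₚ r) +ₚ pr               ≈⟨ +ₚ-assoc (b ·ₚ p) (a ·ₚ r) pr ⟩
    b ·ₚ p +ₚ (a ·ₚ r +ₚ pr)               ∎)
    where
    open SetoidReasoning ≋-setoid
    pr = 0# ∷ p *ₚ r

  *ₚ-comm : ∀ p r → p *ₚ r ≋ r *ₚ p
  *ₚ-comm [] r = ≋-sym (*ₚ-zeroʳ r)
  *ₚ-comm (a ∷ p) r = ≋-trans (+ₚ-cong ≋-refl (∷-cong refl (*ₚ-comm p r))) (≋-sym (*ₚ-∷ʳ r a p))

  *ₚ-identityʳ : ∀ p → p *ₚ 1ₚ ≋ p
  *ₚ-identityʳ p = ≋-trans (*ₚ-comm p 1ₚ) (*ₚ-identityˡ p)

  *ₚ-distribˡ : ∀ p x y → p *ₚ (x +ₚ y) ≋ p *ₚ x +ₚ p *ₚ y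
  *ₚ-distribˡ p x y =
    ≋-trans (*ₚ-comm p _) (≋-trans (*ₚ-distribʳ p x y) (+ₚ-cong (*ₚ-comm x p) (*ₚ-comm y p)))

  polynomialRing : CommutativeRing c ℓ
  polynomialRing = record
    { Carrier = Pol ; _≈_ = _≋_ ; _+_ = _+ₚ_ ; _*_ = _*ₚ_ ; -_ = -ₚ_ ; 0# = 0ₚ ; 1# = 1ₚ
    ; isCommutativeRing = record
      { isRing = record
        { +-isAbelianGroup = record
          { isGroup = record
            { isMonoid = record
              { isSemigroup = record
                { isMagma = record
                  { isEquivalence = Setoid.isEquivalence ≋-setoid
                  ; ∙-cong = +ₚ-cong }
                ; assoc = +ₚ-assoc }
              ; identity = (λ _ → ≋-refl) , +ₚ-identityʳ }
            ; inverse = +ₚ-inverseˡ , (λ p → ≋-trans (+ₚ-comm p _) (+ₚ-inverseˡ p))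
            ; ⁻¹-cong = -ₚ-cong }
          ; comm = +ₚ-comm }
        ; *-cong = *ₚ-cong
        ; *-assoc = *ₚ-assoc
        ; *-identity = *ₚ-identityˡ , *ₚ-identityʳ
        ; distrib = *ₚ-distribˡ , *ₚ-distribʳ }
      ; *-comm = *ₚ-comm } }

  module Polynomial = NaturalCoefficientsSolver (CommutativeRing.commutativeSemiring polynomialRing)

  constₚ-cong : ∀ {a b} → a ≈ b → constₚ a ≋ constₚ b
  constₚ-cong a≈b = ∷-cong a≈b ≋-refl

  ·ₚ≋constₚ*ₚ : ∀ a p → a ·ₚ p ≋ constₚ a *ₚ p
  ·ₚ≋constₚ*ₚ a p = ≋-sym (≋-trans (+ₚ-cong ≋-refl (∷≋0ₚ refl ≋-refl)) (+ₚ-identityʳ (a ·ₚ p)))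

  constₚ-* : ∀ a b → constₚ (a * b) ≋ constₚ a *ₚ constₚ b
  constₚ-* a b = ·ₚ≋constₚ*ₚ a (constₚ b)

  constₚ≋0ₚ : ∀ {a} → a ≈ 0# → constₚ a ≋ 0ₚ
  constₚ≋0ₚ a≈0 = ∷≋0ₚ a≈0 ≋-refl

  0∷≋X*ₚ : ∀ p → (0# ∷ p) ≋ X *ₚ p
  0∷≋X*ₚ p = ≋-sym (+ₚ-cong (·ₚ-zeroˡ p refl) (∷-cong refl (*ₚ-identityˡ p)))

  ∷≋constₚ+X*ₚ : ∀ a p → (a ∷ p) ≋ constₚ a +ₚ X *ₚ p
  ∷≋constₚ+X*ₚ a p = ≋-trans (∷-cong (sym (+-identityʳ a)) ≋-refl) (+ₚ-cong (≋-refl {constₚ a}) (0∷≋X*ₚ p))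

  constₚ-*ₚ-inverse : ∀ {a b} → b * a ≈ 1# → ∀ f → constₚ b *ₚ (constₚ a *ₚ f) ≋ f
  constₚ-*ₚ-inverse {a} {b} ba≈1 f = begin
    constₚ b *ₚ (constₚ a *ₚ f)  ≈⟨ *ₚ-assoc (constₚ b) (constₚ a) f ⟨
    (constₚ b *ₚ constₚ a) *ₚ f  ≈⟨ *ₚ-congˡ f (≋-trans (≋-sym (constₚ-* b a)) (constₚ-cong ba≈1)) ⟩
    1ₚ *ₚ f                      ≈⟨ *ₚ-identityˡ f ⟩
    f                            ∎
    where open SetoidReasoning ≋-setoid

  ∘ₚ-zeroˡ : ∀ {p} m → p ≋ 0ₚ → p ∘ₚ m ≋ 0ₚ
  ∘ₚ-zeroˡ {[]} m e = ≋-refl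
  ∘ₚ-zeroˡ {a ∷ p} m e = +ₚ-cong (constₚ≋0ₚ (coeff≈ e zero))
    (≋-trans (*ₚ-congʳ m (∘ₚ-zeroˡ m (∷≋0ₚ-tail e))) (*ₚ-zeroʳ m))

  ∘ₚ-congˡ : ∀ {p p′} m → p ≋ p′ → p ∘ₚ m ≋ p′ ∘ₚ m
  ∘ₚ-congˡ {[]} {[]} m e = ≋-refl
  ∘ₚ-congˡ {[]} {b ∷ p′} m e = ≋-sym (∘ₚ-zeroˡ m (≋-sym e))
  ∘ₚ-congˡ {a ∷ p} {[]} m e = ∘ₚ-zeroˡ m e
  ∘ₚ-congˡ {a ∷ p} {b ∷ p′} m e =
    +ₚ-cong (constₚ-cong (coeff≈ e zero)) (*ₚ-congʳ m (∘ₚ-congˡ m (∷-tail e)))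

  ∘ₚ-congʳ : ∀ p {m m′} → m ≋ m′ → p ∘ₚ m ≋ p ∘ₚ m′
  ∘ₚ-congʳ [] e = ≋-refl
  ∘ₚ-congʳ (a ∷ p) e = +ₚ-cong ≋-refl (*ₚ-cong e (∘ₚ-congʳ p e))

  constₚ-∘ₚ : ∀ a m → constₚ a ∘ₚ m ≋ constₚ a
  constₚ-∘ₚ a m = ≋-trans (+ₚ-cong ≋-refl (*ₚ-zeroʳ m)) (+ₚ-identityʳ _)

  +ₚ-∘ₚ : ∀ p r m → (p +ₚ r) ∘ₚ m ≋ p ∘ₚ m +ₚ r ∘ₚ m
  +ₚ-∘ₚ [] r m = ≋-refl
  +ₚ-∘ₚ (a ∷ p) [] m = ≋-sym (+ₚ-identityʳ _)
  +ₚ-∘ₚ (a ∷ p) (b ∷ r) m = begin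
    constₚ (a + b) +ₚ m *ₚ ((p +ₚ r) ∘ₚ m)
      ≈⟨ +ₚ-cong ≋-refl (*ₚ-congʳ m (+ₚ-∘ₚ p r m)) ⟩
    (constₚ a +ₚ constₚ b) +ₚ m *ₚ (p ∘ₚ m +ₚ r ∘ₚ m)
      ≈⟨ solve 5 (λ A B M U V → (A :+ B) :+ M :* (U :+ V) := (A :+ M :* U) :+ (B :+ M :* V))
           ≋-refl (constₚ a) (constₚ b) m (p ∘ₚ m) (r ∘ₚ m) ⟩
    (constₚ a +ₚ m *ₚ (p ∘ₚ m)) +ₚ (constₚ b +ₚ m *ₚ (r ∘ₚ m)) ∎
    where open SetoidReasoning ≋-setoid
          open Polynomial using (solve; _:+_; _:*_; _:=_)

  ·ₚ-∘ₚ : ∀ a p m → (a ·ₚ p) ∘ₚ m ≋ constₚ a *ₚ (p ∘ₚ m)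
  ·ₚ-∘ₚ a [] m = ≋-sym (*ₚ-zeroʳ (constₚ a))
  ·ₚ-∘ₚ a (b ∷ p) m = begin
    constₚ (a * b) +ₚ m *ₚ ((a ·ₚ p) ∘ₚ m)
      ≈⟨ +ₚ-cong (constₚ-* a b) (*ₚ-congʳ m (·ₚ-∘ₚ a p m)) ⟩
    constₚ a *ₚ constₚ b +ₚ m *ₚ (constₚ a *ₚ (p ∘ₚ m))
      ≈⟨ solve 4 (λ A B M U → A :* B :+ M :* (A :* U) := A :* (B :+ M :* U))
           ≋-refl (constₚ a) (constₚ b) m (p ∘ₚ m) ⟩
    constₚ a *ₚ (constₚ b +ₚ m *ₚ (p ∘ₚ m)) ∎
    where open SetoidReasoning ≋-setoid
          open Polynomial using (solve; _:+_; _:*_; _:=_)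

  0∷-∘ₚ : ∀ p m → (0# ∷ p) ∘ₚ m ≋ m *ₚ (p ∘ₚ m)
  0∷-∘ₚ p m = +ₚ-cong (constₚ≋0ₚ refl) ≋-refl

  *ₚ-∘ₚ : ∀ p r m → (p *ₚ r) ∘ₚ m ≋ (p ∘ₚ m) *ₚ (r ∘ₚ m)
  *ₚ-∘ₚ [] r m = ≋-refl
  *ₚ-∘ₚ (a ∷ p) r m = begin
    (a ·ₚ r +ₚ (0# ∷ p *ₚ r)) ∘ₚ m
      ≈⟨ +ₚ-∘ₚ (a ·ₚ r) (0# ∷ p *ₚ r) m ⟩
    (a ·ₚ r) ∘ₚ m +ₚ (0# ∷ p *ₚ r) ∘ₚ m
      ≈⟨ +ₚ-cong (·ₚ-∘ₚ a r m) (≋-trans (0∷-∘ₚ (p *ₚ r) m) (*ₚ-congʳ m (*ₚ-∘ₚ p r m))) ⟩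
    constₚ a *ₚ (r ∘ₚ m) +ₚ m *ₚ ((p ∘ₚ m) *ₚ (r ∘ₚ m))
      ≈⟨ solve 4 (λ A R M P → A :* R :+ M :* (P :* R) := (A :+ M :* P) :* R)
           ≋-refl (constₚ a) (r ∘ₚ m) m (p ∘ₚ m) ⟩
    (constₚ a +ₚ m *ₚ (p ∘ₚ m)) *ₚ (r ∘ₚ m) ∎
    where open SetoidReasoning ≋-setoid
          open Polynomial using (solve; _:+_; _:*_; _:=_)

  ∘ₚ-assoc : ∀ p m f → (p ∘ₚ m) ∘ₚ f ≋ p ∘ₚ (m ∘ₚ f)
  ∘ₚ-assoc [] m f = ≋-refl
  ∘ₚ-assoc (a ∷ p) m f = begin
    (constₚ a +ₚ m *ₚ (p ∘ₚ m)) ∘ₚ f        ≈⟨ +ₚ-∘ₚ (constₚ a) (m *ₚ (p ∘ₚ m)) f ⟩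
    constₚ a ∘ₚ f +ₚ (m *ₚ (p ∘ₚ m)) ∘ₚ f   ≈⟨ +ₚ-cong (constₚ-∘ₚ a f) (*ₚ-∘ₚ m (p ∘ₚ m) f) ⟩
    constₚ a +ₚ (m ∘ₚ f) *ₚ ((p ∘ₚ m) ∘ₚ f) ≈⟨ +ₚ-cong ≋-refl (*ₚ-congʳ (m ∘ₚ f) (∘ₚ-assoc p m f)) ⟩
    constₚ a +ₚ (m ∘ₚ f) *ₚ (p ∘ₚ (m ∘ₚ f)) ∎
    where open SetoidReasoning ≋-setoid

  ·ₚ-∘ₚ-assoc : ∀ γ A M f → (γ ·ₚ (A ∘ₚ M)) ∘ₚ f ≋ constₚ γ *ₚ (A ∘ₚ (M ∘ₚ f))
  ·ₚ-∘ₚ-assoc γ A M f = ≋-trans (·ₚ-∘ₚ γ (A ∘ₚ M) f) (*ₚ-congʳ (constₚ γ) (∘ₚ-assoc A M f))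

  X-∘ₚ : ∀ f → X ∘ₚ f ≋ f
  X-∘ₚ f = ≋-trans (0∷-∘ₚ (constₚ 1#) f) (≋-trans (*ₚ-congʳ f (constₚ-∘ₚ 1# f)) (*ₚ-identityʳ f))

  ∘ₚ-constₚ : ∀ p r → p ∘ₚ constₚ r ≋ constₚ (eval p r)
  ∘ₚ-constₚ [] r = ≋-sym (constₚ≋0ₚ refl)
  ∘ₚ-constₚ (a ∷ p) r = +ₚ-cong (≋-refl {constₚ a})
    (≋-trans (*ₚ-congʳ (constₚ r) (∘ₚ-constₚ p r)) (≋-sym (constₚ-* r (eval p r))))

  eval-0# : ∀ p → eval p 0# ≈ coeff p 0
  eval-0# [] = refl
  eval-0# (a ∷ p) = trans (+-congˡ (zeroˡ _)) (+-identityʳ a)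

  ∘ₚ-root : ∀ M {f r} → eval M r ≈ 0# → f ≋ constₚ r → M ∘ₚ f ≋ 0ₚ
  ∘ₚ-root M {r = r} Mr≈0 f≋r = ≋-trans (∘ₚ-congʳ M f≋r) (≋-trans (∘ₚ-constₚ M r) (constₚ≋0ₚ Mr≈0))

  ∘ₚ≋0ₚ⇒root : ∀ M {f r} → f ≋ constₚ r → M ∘ₚ f ≋ 0ₚ → eval M r ≈ 0#
  ∘ₚ≋0ₚ⇒root M {f} {r} f≋r Mf≋0 = coeff≈ (≋-trans (≋-sym (∘ₚ-constₚ M r)) (≋-trans (∘ₚ-congʳ M (≋-sym f≋r)) Mf≋0)) 0

  open SemiringExp (CommutativeRing.semiring polynomialRing) public
    using () renaming (_^_ to _^ₚ_)

  Xpow-∘ₚ : ∀ k f → Xpow k ∘ₚ f ≋ f ^ₚ k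
  Xpow-∘ₚ zero f = constₚ-∘ₚ 1# f
  Xpow-∘ₚ (suc k) f = ≋-trans (0∷-∘ₚ (Xpow k) f) (*ₚ-congʳ f (Xpow-∘ₚ k f))

  coeff-Xpow-≢ : ∀ m {j} → j ≢ m → coeff (Xpow m) j ≈ 0#
  coeff-Xpow-≢ zero {zero} j≢m = ⊥-elim (j≢m ≡.refl)
  coeff-Xpow-≢ zero {suc j} j≢m = refl
  coeff-Xpow-≢ (suc m) {zero} j≢m = refl
  coeff-Xpow-≢ (suc m) {suc j} j≢m = coeff-Xpow-≢ m (j≢m ∘ ≡.cong suc)

  linearFactor-∘ₚ : ∀ r f → ((- r) ∷ 1# ∷ []) ∘ₚ f ≋ f +ₚ constₚ (- r)
  linearFactor-∘ₚ r f = ≋-trans (+ₚ-cong ≋-refl (≋-trans (*ₚ-congʳ f (constₚ-∘ₚ 1# f)) (*ₚ-identityʳ f)))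
    (+ₚ-comm (constₚ (- r)) f)

  natMul≡× : ∀ k a → natMul k a ≡ k × a
  natMul≡× zero a = ≡.refl
  natMul≡× (suc k) a = ≡.cong (a +_) (natMul≡× k a)

  coeff-derivFrom : ∀ k p i → coeff (derivFrom k p) i ≈ (i ℕ.+ k) × coeff p i
  coeff-derivFrom k [] i = sym (×-zeroʳ (i ℕ.+ k))
  coeff-derivFrom k (a ∷ p) zero = reflexive (natMul≡× k a)
  coeff-derivFrom k (a ∷ p) (suc i) =
    trans (coeff-derivFrom (suc k) p i) (reflexive (≡.cong (_× coeff p i) (ℕₚ.+-suc i k)))

  coeff-deriv : ∀ p i → coeff (deriv p) i ≈ suc i × coeff p (suc i)
  coeff-deriv [] i = sym (×-zeroʳ (suc i))
  coeff-deriv (a ∷ p) i =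
    trans (coeff-derivFrom 1 p i) (reflexive (≡.cong (_× coeff p i) (ℕₚ.+-comm i 1)))

  deriv-cong : ∀ {p r} → p ≋ r → deriv p ≋ deriv r
  deriv-cong {p} {r} e = mk≋ λ i →
    trans (coeff-deriv p i) (trans (×-congʳ (suc i) (coeff≈ e (suc i))) (sym (coeff-deriv r i)))

  deriv-+ₚ : ∀ p r → deriv (p +ₚ r) ≋ deriv p +ₚ deriv r
  deriv-+ₚ p r = mk≋ λ i → begin
    coeff (deriv (p +ₚ r)) i                        ≈⟨ coeff-deriv (p +ₚ r) i ⟩
    suc i × coeff (p +ₚ r) (suc i)                  ≈⟨ ×-congʳ (suc i) (coeff-+ₚ p r (suc i)) ⟩
    suc i × (coeff p (suc i) + coeff r (suc i))     ≈⟨ ×-distrib-+ _ _ (suc i) ⟩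
    suc i × coeff p (suc i) + suc i × coeff r (suc i)
      ≈⟨ trans (coeff-+ₚ (deriv p) (deriv r) i) (+-cong (coeff-deriv p i) (coeff-deriv r i)) ⟨
    coeff (deriv p +ₚ deriv r) i                    ∎
    where open SetoidReasoning setoid

  deriv-·ₚ : ∀ a p → deriv (a ·ₚ p) ≋ a ·ₚ deriv p
  deriv-·ₚ a p = mk≋ λ i → begin
    coeff (deriv (a ·ₚ p)) i        ≈⟨ coeff-deriv (a ·ₚ p) i ⟩
    suc i × coeff (a ·ₚ p) (suc i)  ≈⟨ ×-congʳ (suc i) (coeff-·ₚ a p (suc i)) ⟩
    suc i × (a * coeff p (suc i))   ≈⟨ ×-comm-* (suc i) a _ ⟨
    a * (suc i × coeff p (suc i))   ≈⟨ trans (coeff-·ₚ a (deriv p) i) (*-congˡ (coeff-deriv p i)) ⟨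
    coeff (a ·ₚ deriv p) i          ∎
    where open SetoidReasoning setoid

  deriv-0∷ : ∀ p → deriv (0# ∷ p) ≋ p +ₚ (0# ∷ deriv p)
  deriv-0∷ p = mk≋ λ i → trans (coeff-deriv (0# ∷ p) i) (sym (trans (coeff-+ₚ p (0# ∷ deriv p) i) (shifted i)))
    where
    shifted : ∀ i → coeff p i + coeff (0# ∷ deriv p) i ≈ suc i × coeff p i
    shifted zero = refl
    shifted (suc i) = +-congˡ (coeff-deriv p i)

  deriv-∷ : ∀ a p → deriv (a ∷ p) ≋ p +ₚ X *ₚ deriv p
  deriv-∷ a p = ≋-trans (deriv-0∷ p) (+ₚ-cong (≋-refl {p}) (0∷≋X*ₚ (deriv p)))

  deriv-*ₚ : ∀ p r → deriv (p *ₚ r) ≋ deriv p *ₚ r +ₚ p *ₚ deriv r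
  deriv-*ₚ [] r = ≋-refl
  deriv-*ₚ (a ∷ p) r = begin
    deriv (a ·ₚ r +ₚ (0# ∷ p *ₚ r))
      ≈⟨ deriv-+ₚ (a ·ₚ r) (0# ∷ p *ₚ r) ⟩
    deriv (a ·ₚ r) +ₚ deriv (0# ∷ p *ₚ r)
      ≈⟨ +ₚ-cong (≋-trans (deriv-·ₚ a r) (·ₚ≋constₚ*ₚ a (deriv r))) (deriv-∷ 0# (p *ₚ r)) ⟩
    constₚ a *ₚ deriv r +ₚ (p *ₚ r +ₚ X *ₚ deriv (p *ₚ r))
      ≈⟨ +ₚ-cong (≋-refl {constₚ a *ₚ deriv r}) (+ₚ-cong (≋-refl {p *ₚ r}) (*ₚ-congʳ X (deriv-*ₚ p r))) ⟩
    constₚ a *ₚ deriv r +ₚ (p *ₚ r +ₚ X *ₚ (deriv p *ₚ r +ₚ p *ₚ deriv r))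
      ≈⟨ solve 6 (λ A R R′ P P′ Y → A :* R′ :+ (P :* R :+ Y :* (P′ :* R :+ P :* R′))
                                    := (P :+ Y :* P′) :* R :+ (A :+ Y :* P) :* R′)
           ≋-refl (constₚ a) r (deriv r) p (deriv p) X ⟩
    (p +ₚ X *ₚ deriv p) *ₚ r +ₚ (constₚ a +ₚ X *ₚ p) *ₚ deriv r
      ≈⟨ +ₚ-cong (*ₚ-congˡ r (≋-sym (deriv-∷ a p))) (*ₚ-congˡ (deriv r) (≋-sym (∷≋constₚ+X*ₚ a p))) ⟩
    deriv (a ∷ p) *ₚ r +ₚ (a ∷ p) *ₚ deriv r ∎
    where open SetoidReasoning ≋-setoid
          open Polynomial using (solve; _:+_; _:*_; _:=_)

  deriv-∘ₚ : ∀ p f → deriv (p ∘ₚ f) ≋ (deriv p ∘ₚ f) *ₚ deriv f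
  deriv-∘ₚ [] f = ≋-refl
  deriv-∘ₚ (a ∷ p) f = begin
    deriv (constₚ a +ₚ f *ₚ (p ∘ₚ f))
      ≈⟨ deriv-+ₚ (constₚ a) (f *ₚ (p ∘ₚ f)) ⟩
    deriv (f *ₚ (p ∘ₚ f))
      ≈⟨ deriv-*ₚ f (p ∘ₚ f) ⟩
    deriv f *ₚ (p ∘ₚ f) +ₚ f *ₚ deriv (p ∘ₚ f)
      ≈⟨ +ₚ-cong (≋-refl {deriv f *ₚ (p ∘ₚ f)}) (*ₚ-congʳ f (deriv-∘ₚ p f)) ⟩
    deriv f *ₚ (p ∘ₚ f) +ₚ f *ₚ ((deriv p ∘ₚ f) *ₚ deriv f)
      ≈⟨ solve 4 (λ F′ P F Q → F′ :* P :+ F :* (Q :* F′) := (P :+ F :* Q) :* F′)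
           ≋-refl (deriv f) (p ∘ₚ f) f (deriv p ∘ₚ f) ⟩
    (p ∘ₚ f +ₚ f *ₚ (deriv p ∘ₚ f)) *ₚ deriv f
      ≈⟨ *ₚ-congˡ (deriv f) (≋-sym (≋-trans (+ₚ-∘ₚ p (X *ₚ deriv p) f)
           (+ₚ-cong (≋-refl {p ∘ₚ f}) (≋-trans (*ₚ-∘ₚ X (deriv p) f) (*ₚ-congˡ _ (X-∘ₚ f)))))) ⟩
    ((p +ₚ X *ₚ deriv p) ∘ₚ f) *ₚ deriv f
      ≈⟨ *ₚ-congˡ (deriv f) (∘ₚ-congˡ f (deriv-∷ a p)) ⟨
    (deriv (a ∷ p) ∘ₚ f) *ₚ deriv f ∎
    where open SetoidReasoning ≋-setoid
          open Polynomial using (solve; _:+_; _:*_; _:=_)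

  deriv≋constₚ⇒deriv-∘ₚ : ∀ {P μ} → deriv P ≋ constₚ μ → ∀ f → deriv (P ∘ₚ f) ≋ constₚ μ *ₚ deriv f
  deriv≋constₚ⇒deriv-∘ₚ {P} {μ} P′≋μ f =
    ≋-trans (deriv-∘ₚ P f) (*ₚ-congˡ (deriv f) (≋-trans (∘ₚ-congˡ f P′≋μ) (constₚ-∘ₚ μ f)))

prime∤! : ∀ {p} → Prime p → ∀ {m} → m < p → p ∤ m !
prime∤! pp {zero} m<p p∣1 with ∣1⇒≡1 p∣1 | prime⇒nonTrivial pp
... | ≡.refl | ()
prime∤! pp {suc m} m<p p∣m! with euclidsLemma (suc m) (m !) pp p∣m!
... | inj₁ p∣sm = ℕₚ.<-irrefl ≡.refl (ℕₚ.≤-trans m<p (∣⇒≤ p∣sm))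
... | inj₂ p∣m! = prime∤! pp (ℕₚ.<-trans (ℕₚ.n<1+n m) m<p) p∣m!

prime∣C : ∀ {p k} → Prime p → 0 < k → k < p → p ∣ p C k
prime∣C {p} {k} pp 0<k k<p with euclidsLemma (k ! ℕ.* (p ∸ k) !) (p C k) pp p∣k![p-k]!C
  where
  k![p-k]!C≡p! : k ! ℕ.* (p ∸ k) ! ℕ.* (p C k) ≡ p !
  k![p-k]!C≡p! = ≡.trans (≡.cong (k ! ℕ.* (p ∸ k) ! ℕ.*_) (nCk≡n!/k![n-k]! (ℕₚ.<⇒≤ k<p)))
    (m*[n/m]≡n {{k !* (p ∸ k) !≢0}} (k![n∸k]!∣n! (ℕₚ.<⇒≤ k<p)))
  p∣k![p-k]!C : p ∣ k ! ℕ.* (p ∸ k) ! ℕ.* (p C k)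
  p∣k![p-k]!C = ≡.subst (p ∣_) (≡.sym k![p-k]!C≡p!) (p∣p! p {{prime⇒nonZero pp}})
    where
    p∣p! : ∀ n → .{{NonZero n}} → n ∣ n !
    p∣p! (suc n) = m∣m*n (n !)
... | inj₂ p∣C = p∣C
... | inj₁ p∣k![p-k]! with euclidsLemma (k !) ((p ∸ k) !) pp p∣k![p-k]!
...   | inj₁ p∣k! = ⊥-elim (prime∤! pp k<p p∣k!)
...   | inj₂ p∣[p-k]! = ⊥-elim (prime∤! pp (ℕₚ.∸-monoʳ-< 0<k (ℕₚ.<⇒≤ k<p)) p∣[p-k]!)

module Frobenius {a ℓ} (S : CommutativeSemiring a ℓ) where
  open CommutativeSemiring S hiding (zero)
  open import Algebra.Properties.Semiring.Exp semiring using () renaming (_^_ to _^ˢ_)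
  open import Algebra.Properties.Semiring.Mult semiring using (_×_; ×-cong; ×-congʳ; ×-congˡ; ×-assocˡ)
  open import Algebra.Properties.Monoid.Sum +-monoid using (sum; sum-init-last; sum-cong-≋; sum-replicate-zero)
  open import Algebra.Properties.CommutativeSemiring.Binomial S using (theorem; binomialExpansion; binomialTerm)
  open SemiringMultiples semiring using (×-zeroʳ)
  open SetoidReasoning setoid

  -- In characteristic p only the two extreme terms of the binomial expansion survive.
  frobenius : ∀ {p} → Prime p → (∀ z → p × z ≈ 0#) → ∀ x y → (x + y) ^ˢ p ≈ x ^ˢ p + y ^ˢ p
  frobenius {zero} pp = ⊥-elim (ℕ.≢-nonZero⁻¹ 0 {{prime⇒nonZero pp}} ≡.refl)
  frobenius {suc m} pp char x y = begin
    (x + y) ^ˢ p                                      ≈⟨ theorem p x y ⟩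
    binomialExpansion x y p                           ≈⟨ +-congˡ (sum-init-last (tail t)) ⟩
    t Fin.zero + (sum (init (tail t)) + t (fromℕ p))  ≈⟨ +-cong first (+-cong middle last) ⟩
    y ^ˢ p + (0# + x ^ˢ p)                            ≈⟨ trans (+-congˡ (+-identityˡ _)) (+-comm _ _) ⟩
    x ^ˢ p + y ^ˢ p                                   ∎
    where
    p = suc m
    t = binomialTerm x y p
    first : t Fin.zero ≈ y ^ˢ p
    first = trans (×-congˡ (≡.trans (nCk≡nC[n∸k] {0} {p} z≤n) (nCn≡1 p)))
                  (trans (+-identityʳ _) (*-identityˡ _))
    extreme : ∀ {k} → k ≡ p → (p C k) × (x ^ˢ k * y ^ˢ (p ∸ k)) ≈ x ^ˢ p
    extreme ≡.refl = trans (×-cong (nCn≡1 p) (*-congˡ (reflexive (≡.cong (y ^ˢ_) (ℕₚ.n∸n≡0 p)))))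
                           (trans (+-identityʳ _) (*-identityʳ _))
    last : t (fromℕ p) ≈ x ^ˢ p
    last = extreme (toℕ-fromℕ p)
    vanishes : ∀ {k} → 0 < k → k < p → ∀ z → (p C k) × z ≈ 0#
    vanishes 0<k k<p z with prime∣C pp 0<k k<p
    ... | divides c eq = trans (×-congˡ eq) (trans (sym (×-assocˡ z c p)) (trans (×-congʳ c (char z)) (×-zeroʳ c)))
    middle : sum (init (tail t)) ≈ 0#
    middle = trans (sum-cong-≋ λ i → vanishes (s≤s z≤n)
                     (s≤s (≡.subst (_< m) (≡.sym (toℕ-inject₁ i)) (toℕ<n i))) _)
                   (sum-replicate-zero m)

module DistinctSum {c ℓ} (M : CommutativeMonoid c ℓ) where
  open CommutativeMonoid M renaming (Carrier to A)

  ∑ : List A → A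
  ∑ = foldr _∙_ ε

  ∑-distinct⊆ : ∀ xs ys → AllPairs (λ a b → ¬ (a ≈ b)) xs → All (λ x → Any (x ≈_) ys) xs
              → length xs ≡ length ys → ∑ xs ≈ ∑ ys
  ∑-distinct⊆ [] [] _ _ _ = refl
  ∑-distinct⊆ (x ∷ xs) ys (x≉ ∷ distinct) (x∈ ∷ xs⊆) |xs|≡|ys| = trans
    (∙-congˡ (∑-distinct⊆ xs (remove ys x∈) distinct
      (All.zipWith (λ (x≉z , z∈) → ∈-remove ys x∈ z∈ (x≉z ∘ sym)) (x≉ , xs⊆))
      (ℕₚ.suc-injective (≡.trans |xs|≡|ys| (≡.sym (length-remove ys x∈))))))
    (sym (∑-remove ys x∈))
    where
    remove : ∀ {x} ys → Any (x ≈_) ys → List A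
    remove (y ∷ ys) (here _) = ys
    remove (y ∷ ys) (there x∈) = y ∷ remove ys x∈
    ∑-remove : ∀ {x} ys (x∈ : Any (x ≈_) ys) → ∑ ys ≈ x ∙ ∑ (remove ys x∈)
    ∑-remove (y ∷ ys) (here x≈y) = ∙-congʳ (sym x≈y)
    ∑-remove {x} (y ∷ ys) (there x∈) = trans (∙-congˡ (∑-remove ys x∈))
      (trans (sym (assoc y x _)) (trans (∙-congʳ (comm y x)) (assoc x y _)))
    length-remove : ∀ {x} ys (x∈ : Any (x ≈_) ys) → suc (length (remove ys x∈)) ≡ length ys
    length-remove (y ∷ ys) (here _) = ≡.refl
    length-remove (y ∷ ys) (there x∈) = ≡.cong suc (length-remove ys x∈)
    ∈-remove : ∀ {x z} ys (x∈ : Any (x ≈_) ys) → Any (z ≈_) ys → ¬ (z ≈ x) → Any (z ≈_) (remove ys x∈)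
    ∈-remove (y ∷ ys) (here x≈y) (here z≈y) z≉x = ⊥-elim (z≉x (trans z≈y (sym x≈y)))
    ∈-remove (y ∷ ys) (here _) (there z∈) _ = z∈
    ∈-remove (y ∷ ys) (there x∈) (here z≈y) _ = here z≈y
    ∈-remove (y ∷ ys) (there x∈) (there z∈) z≉x = there (∈-remove ys x∈ z∈ z≉x)

module FiniteField {c ℓ} (R : CommutativeRing c ℓ) {N : ℕ} (F : IsFiniteFieldOfSize R N) where
  open CommutativeRing R renaming (Carrier to K)
  open IsFiniteFieldOfSize F
  open RingProperties ring using (+-cancelʳ; +-identityʳ-unique)
  open SemiringMult semiring using (_×_)
  open SemiringExp semiring using () renaming (_^_ to _^ᴷ_)
  open SetoidReasoning setoid
  module Scalar = NaturalCoefficientsSolver commutativeSemiring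

  _≟_ : ∀ x y → Dec (x ≈ y)
  x ≟ y = listed (elems-all x) (elems-all y) elems-dist
    where
    ≉-any : ∀ {e z zs} → All (λ w → ¬ (e ≈ w)) zs → Any (z ≈_) zs → ¬ (e ≈ z)
    ≉-any (e≉w ∷ _) (here z≈w) e≈z = e≉w (trans e≈z z≈w)
    ≉-any (_ ∷ e≉ws) (there z∈) e≈z = ≉-any e≉ws z∈ e≈z
    listed : ∀ {zs} → Any (x ≈_) zs → Any (y ≈_) zs → AllPairs (λ a b → ¬ (a ≈ b)) zs → Dec (x ≈ y)
    listed (here x≈w) (here y≈w) _ = yes (trans x≈w (sym y≈w))
    listed (here x≈w) (there y∈) (w≉ ∷ _) = no λ x≈y → ≉-any w≉ y∈ (trans (sym x≈w) x≈y)
    listed (there x∈) (here y≈w) (w≉ ∷ _) = no λ x≈y → ≉-any w≉ x∈ (trans (sym y≈w) (sym x≈y))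
    listed (there x∈) (there y∈) (_ ∷ distinct) = listed x∈ y∈ distinct

  *-cancelˡ-≈0 : ∀ {a b} → ¬ (a ≈ 0#) → a * b ≈ 0# → b ≈ 0#
  *-cancelˡ-≈0 {a} {b} a≉0 ab≈0 with inverse a a≉0
  ... | a⁻¹ , aa⁻¹≈1 = begin
    b                ≈⟨ *-identityˡ b ⟨
    1# * b           ≈⟨ *-congʳ aa⁻¹≈1 ⟨
    (a * a⁻¹) * b    ≈⟨ trans (*-congʳ (*-comm a a⁻¹)) (*-assoc a⁻¹ a b) ⟩
    a⁻¹ * (a * b)    ≈⟨ *-congˡ ab≈0 ⟩
    a⁻¹ * 0#         ≈⟨ zeroʳ a⁻¹ ⟩
    0#               ∎

  *-≉0 : ∀ {a b} → ¬ (a ≈ 0#) → ¬ (b ≈ 0#) → ¬ (a * b ≈ 0#)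
  *-≉0 a≉0 b≉0 ab≈0 = b≉0 (*-cancelˡ-≈0 a≉0 ab≈0)

  inverse-≉0 : ∀ a (a≉0 : ¬ (a ≈ 0#)) → ¬ (proj₁ (inverse a a≉0) ≈ 0#)
  inverse-≉0 a a≉0 a⁻¹≈0 = nontrivial (trans (sym (proj₂ (inverse a a≉0))) (trans (*-congˡ a⁻¹≈0) (zeroʳ a)))

  ^ᴷ-≈0⇒≈0 : ∀ {x} m → x ^ᴷ m ≈ 0# → x ≈ 0#
  ^ᴷ-≈0⇒≈0 {x} m xᵐ≈0 with x ≟ 0#
  ... | yes x≈0 = x≈0
  ... | no x≉0 = ⊥-elim (^-≉0 m xᵐ≈0)
    where
    ^-≉0 : ∀ m → ¬ (x ^ᴷ m ≈ 0#)
    ^-≉0 zero = nontrivial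
    ^-≉0 (suc m) = *-≉0 x≉0 (^-≉0 m)

  open DistinctSum +-commutativeMonoid using (∑; ∑-distinct⊆)

  ∑-map-+1 : ∀ xs → ∑ (map (_+ 1#) xs) ≈ ∑ xs + length xs × 1#
  ∑-map-+1 [] = sym (+-identityʳ 0#)
  ∑-map-+1 (x ∷ xs) = trans (+-congˡ (∑-map-+1 xs))
    (Scalar.solve 4 (λ x o s m → (x :+ o) :+ (s :+ m) := (x :+ s) :+ (o :+ m)) refl x 1# (∑ xs) (length xs × 1#))
    where open Scalar using (_:+_; _:=_)

  -- Translating by 1 permutes the elements, so it leaves their sum unchanged.
  ∑-elems-+1 : ∑ elems + N × 1# ≈ ∑ elems
  ∑-elems-+1 = begin
    ∑ elems + N × 1#             ≈⟨ +-congˡ (reflexive (≡.cong (_× 1#) (≡.sym elems-size))) ⟩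
    ∑ elems + length elems × 1#  ≈⟨ ∑-map-+1 elems ⟨
    ∑ (map (_+ 1#) elems)        ≈⟨ ∑-distinct⊆ (map (_+ 1#) elems) elems
                                      (AllPairsₚ.map⁺ (AllPairs.map (λ a≉b e → a≉b (+-cancelʳ 1# _ _ e)) elems-dist))
                                      (All.universal elems-all _) (Listₚ.length-map (_+ 1#) elems) ⟩
    ∑ elems                      ∎

  size×1≈0 : N × 1# ≈ 0#
  size×1≈0 = +-identityʳ-unique (∑ elems) (N × 1#) ∑-elems-+1

module PolynomialsOverFiniteField {c ℓ} (R : CommutativeRing c ℓ) (q n : ℕ) {N : ℕ}
                                  (F : IsFiniteFieldOfSize R N) where
  open Poly R q n hiding (zero)
  open PolynomialRing R q n
  open FiniteField R F using (_≟_; *-cancelˡ-≈0; *-≉0; inverse-≉0)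
  open IsFiniteFieldOfSize F using (nontrivial; inverse)

  *ₚ-noZeroDivisors : ∀ p r → p *ₚ r ≋ 0ₚ → p ≋ 0ₚ ⊎ r ≋ 0ₚ
  *ₚ-noZeroDivisors [] r _ = inj₁ ≋-refl
  *ₚ-noZeroDivisors (a ∷ p) r pr≋0 with a ≟ 0#
  ... | no a≉0 = inj₂ (leading {p = p} a≉0 r pr≋0)
    where
    leading : ∀ {a p} → ¬ (a ≈ 0#) → ∀ r → (a ∷ p) *ₚ r ≋ 0ₚ → r ≋ 0ₚ
    leading a≉0 [] _ = ≋-refl
    leading {a} {p} a≉0 (b ∷ r) pr≋0 = ∷≋0ₚ b≈0 (leading {p = p} a≉0 r (∷≋0ₚ-tail (≋-trans (≋-sym shifted) pr≋0)))
      where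
      b≈0 : b ≈ 0#
      b≈0 = *-cancelˡ-≈0 a≉0 (trans (sym (+-identityʳ _)) (coeff≈ pr≋0 zero))
      shifted : (a ∷ p) *ₚ (b ∷ r) ≋ 0# ∷ (a ∷ p) *ₚ r
      shifted = ≋-trans (*ₚ-∷ʳ (a ∷ p) b r) (+ₚ-cong (·ₚ-zeroˡ (a ∷ p) b≈0) ≋-refl)
  ... | yes a≈0 with *ₚ-noZeroDivisors p r (∷≋0ₚ-tail (≋-trans (≋-sym (+ₚ-cong (·ₚ-zeroˡ r a≈0) ≋-refl)) pr≋0))
  ...   | inj₁ p≋0 = inj₁ (∷≋0ₚ a≈0 p≋0)
  ...   | inj₂ r≋0 = inj₂ r≋0

  prodLin-∘ₚ≋0ₚ⇒constant : ∀ rs f → prodLin rs ∘ₚ f ≋ 0ₚ → ∃ λ r → f ≋ constₚ r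
  prodLin-∘ₚ≋0ₚ⇒constant [] f 1≋0 = ⊥-elim (nontrivial (coeff≈ (≋-trans (≋-sym (constₚ-∘ₚ 1# f)) 1≋0) zero))
  prodLin-∘ₚ≋0ₚ⇒constant (r ∷ rs) f e = [ factor-root , prodLin-∘ₚ≋0ₚ⇒constant rs f ]′
    (*ₚ-noZeroDivisors (factor ∘ₚ f) (prodLin rs ∘ₚ f) (≋-trans (≋-sym (*ₚ-∘ₚ factor (prodLin rs) f)) e))
    where
    factor = (- r) ∷ 1# ∷ []
    factor-root : factor ∘ₚ f ≋ 0ₚ → ∃ λ r → f ≋ constₚ r
    factor-root factor≋0 = r , (begin
      f                               ≈⟨ +ₚ-identityʳ f ⟨
      f +ₚ 0ₚ                         ≈⟨ +ₚ-cong (≋-refl {f}) (constₚ≋0ₚ (-‿inverseˡ r)) ⟨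
      f +ₚ (constₚ (- r) +ₚ constₚ r) ≈⟨ +ₚ-assoc f (constₚ (- r)) (constₚ r) ⟨
      (f +ₚ constₚ (- r)) +ₚ constₚ r ≈⟨ +ₚ-cong (≋-trans (≋-sym (linearFactor-∘ₚ r f)) factor≋0) ≋-refl ⟩
      constₚ r                        ∎)
      where open SetoidReasoning ≋-setoid

  splits-∘ₚ≋0ₚ⇒constant : ∀ {P} f → Splits P → ¬ (P ≋ 0ₚ) → P ∘ₚ f ≋ 0ₚ → ∃ λ r → f ≋ constₚ r
  splits-∘ₚ≋0ₚ⇒constant {P} f (a , rs , P≈) P≉0 Pf≋0 = [ lead≋0-absurd , prodLin-∘ₚ≋0ₚ⇒constant rs f ]′
    (*ₚ-noZeroDivisors (constₚ a) (prodLin rs ∘ₚ f)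
      (≋-trans (≋-sym (·ₚ-∘ₚ a (prodLin rs) f)) (≋-trans (∘ₚ-congˡ f (≋-sym P≋)) Pf≋0)))
    where
    P≋ : P ≋ a ·ₚ prodLin rs
    P≋ = mk≋ P≈
    lead≋0-absurd : constₚ a ≋ 0ₚ → ∃ λ r → f ≋ constₚ r
    lead≋0-absurd a≋0 = ⊥-elim (P≉0 (≋-trans P≋ (·ₚ-zeroˡ (prodLin rs) (coeff≈ a≋0 zero))))

  splits⇒root : ∀ {P d} → Splits P → MonicOfDegree P d → 0 ℕ.< d → ∃ λ r → P ∘ₚ constₚ r ≋ 0ₚ
  splits⇒root {d = suc d} (a , [] , P≈) (lead≈1 , _) _ = ⊥-elim (nontrivial (trans (sym lead≈1) (P≈ (suc d))))
  splits⇒root {P} (a , r ∷ rs , P≈) _ _ = r , (begin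
    P ∘ₚ constₚ r                                ≈⟨ ∘ₚ-congˡ (constₚ r) P≋ ⟩
    (a ·ₚ (factor *ₚ prodLin rs)) ∘ₚ constₚ r    ≈⟨ ·ₚ-∘ₚ a (factor *ₚ prodLin rs) (constₚ r) ⟩
    constₚ a *ₚ ((factor *ₚ prodLin rs) ∘ₚ constₚ r)
      ≈⟨ *ₚ-congʳ (constₚ a) (≋-trans (*ₚ-∘ₚ factor (prodLin rs) (constₚ r)) (*ₚ-zeroˡ _ factor-root)) ⟩
    constₚ a *ₚ 0ₚ                               ≈⟨ *ₚ-zeroʳ (constₚ a) ⟩
    0ₚ                                           ∎)
    where
    open SetoidReasoning ≋-setoid
    factor = (- r) ∷ 1# ∷ []
    P≋ : P ≋ a ·ₚ (factor *ₚ prodLin rs)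
    P≋ = mk≋ P≈
    factor-root : factor ∘ₚ constₚ r ≋ 0ₚ
    factor-root = ≋-trans (linearFactor-∘ₚ r (constₚ r)) (constₚ≋0ₚ (-‿inverseʳ r))

  -- Evaluating u P + v P′ = 1 at a root of P gives 0 = 1 once P′ = 0.
  separable-root⇒deriv≉0 : ∀ {P r} → Separable P → P ∘ₚ constₚ r ≋ 0ₚ → ¬ (deriv P ≋ 0ₚ)
  separable-root⇒deriv≉0 {P} {r} (u , v , uP+vP′≈1) root P′≋0 =
    nontrivial (coeff≈ (≋-trans (≋-sym (constₚ-∘ₚ 1# (constₚ r)))
                          (≋-trans (∘ₚ-congˡ (constₚ r) (≋-sym uP≋1)) uP-root)) zero)
    where
    uP≋1 : u *ₚ P ≋ 1ₚ
    uP≋1 = ≋-trans (≋-sym (+ₚ-identityʳ (u *ₚ P)))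
             (≋-trans (+ₚ-cong (≋-refl {u *ₚ P}) (≋-sym (≋-trans (*ₚ-congʳ v P′≋0) (*ₚ-zeroʳ v))))
               (mk≋ uP+vP′≈1))
    uP-root : (u *ₚ P) ∘ₚ constₚ r ≋ 0ₚ
    uP-root = ≋-trans (*ₚ-∘ₚ u P (constₚ r)) (≋-trans (*ₚ-congʳ (u ∘ₚ constₚ r) root) (*ₚ-zeroʳ (u ∘ₚ constₚ r)))

  Xpow[qⁿ]-X : Pol
  Xpow[qⁿ]-X = Xpow (q ^ n) +ₚ (-ₚ X)

  W-transfer : ∀ {T T′ f g γ μ} → ¬ (γ ≈ 0#) → ¬ (μ ≈ 0#)
             → T ∘ₚ f ≋ constₚ γ *ₚ (T′ ∘ₚ g) → deriv g ≋ constₚ μ *ₚ deriv f → W T f → W T′ g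
  W-transfer {T} {T′} {f} {g} {γ} {μ} γ≉0 μ≉0 Tf≋γT′g g′≋μf′ (θ , θ≉0 , Tf≈) =
    γ⁻¹ * (θ * μ⁻¹) , *-≉0 (inverse-≉0 γ γ≉0) (*-≉0 θ≉0 (inverse-≉0 μ μ≉0)) , coeff≈ (begin
      T′ ∘ₚ g                                   ≈⟨ constₚ-*ₚ-inverse (trans (*-comm γ⁻¹ γ) γγ⁻¹≈1) (T′ ∘ₚ g) ⟨
      Γ⁻¹ *ₚ (constₚ γ *ₚ (T′ ∘ₚ g))            ≈⟨ *ₚ-congʳ Γ⁻¹ (≋-trans (≋-sym Tf≋γT′g) (mk≋ Tf≈)) ⟩
      Γ⁻¹ *ₚ (θ ·ₚ (Z *ₚ deriv f))
        ≈⟨ *ₚ-congʳ Γ⁻¹ (≋-trans (·ₚ≋constₚ*ₚ θ _) (*ₚ-congʳ Θ (*ₚ-congʳ Z f′≋))) ⟩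
      Γ⁻¹ *ₚ (Θ *ₚ (Z *ₚ (Μ⁻¹ *ₚ deriv g)))
        ≈⟨ solve 5 (λ A B C Z D → A :* (B :* (Z :* (C :* D))) := (A :* (B :* C)) :* (Z :* D))
             ≋-refl Γ⁻¹ Θ Μ⁻¹ Z (deriv g) ⟩
      (Γ⁻¹ *ₚ (Θ *ₚ Μ⁻¹)) *ₚ (Z *ₚ deriv g)
        ≈⟨ *ₚ-congˡ _ (≋-trans (*ₚ-congʳ Γ⁻¹ (≋-sym (constₚ-* θ μ⁻¹))) (≋-sym (constₚ-* γ⁻¹ (θ * μ⁻¹)))) ⟩
      constₚ (γ⁻¹ * (θ * μ⁻¹)) *ₚ (Z *ₚ deriv g) ≈⟨ ·ₚ≋constₚ*ₚ _ _ ⟨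
      (γ⁻¹ * (θ * μ⁻¹)) ·ₚ (Z *ₚ deriv g)        ∎)
    where
    open SetoidReasoning ≋-setoid
    open Polynomial using (solve; _:*_; _:=_)
    γ⁻¹ = proj₁ (inverse γ γ≉0)
    γγ⁻¹≈1 = proj₂ (inverse γ γ≉0)
    μ⁻¹ = proj₁ (inverse μ μ≉0)
    μμ⁻¹≈1 = proj₂ (inverse μ μ≉0)
    Z = Xpow[qⁿ]-X
    Γ⁻¹ = constₚ γ⁻¹
    Θ = constₚ θ
    Μ⁻¹ = constₚ μ⁻¹
    f′≋ : deriv f ≋ Μ⁻¹ *ₚ deriv g
    f′≋ = ≋-sym (≋-trans (*ₚ-congʳ Μ⁻¹ g′≋μf′) (constₚ-*ₚ-inverse (trans (*-comm μ⁻¹ μ) μμ⁻¹≈1) (deriv f)))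

  W-rhs≋0ₚ : ∀ θ {f} → deriv f ≋ 0ₚ → θ ·ₚ (Xpow[qⁿ]-X *ₚ deriv f) ≋ 0ₚ
  W-rhs≋0ₚ θ f′≋0 = ·ₚ-zeroʳ θ (≋-trans (*ₚ-congʳ Xpow[qⁿ]-X f′≋0) (*ₚ-zeroʳ Xpow[qⁿ]-X))

  W⇒root : ∀ {T f} → W T f → deriv f ≋ 0ₚ → T ∘ₚ f ≋ 0ₚ
  W⇒root {T} {f} (θ , _ , Tf≈) f′≋0 = ≋-trans (mk≋ {T ∘ₚ f} Tf≈) (W-rhs≋0ₚ θ {f} f′≋0)

  root⇒W : ∀ {T f} → T ∘ₚ f ≋ 0ₚ → deriv f ≋ 0ₚ → W T f
  root⇒W {f = f} Tf≋0 f′≋0 = 1# , nontrivial , coeff≈ (≋-trans Tf≋0 (≋-sym (W-rhs≋0ₚ 1# {f} f′≋0)))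

  monic⇒≉0ₚ : ∀ {P d} → MonicOfDegree P d → ¬ (P ≋ 0ₚ)
  monic⇒≉0ₚ {d = d} (lead≈1 , _) P≋0 = nontrivial (trans (sym lead≈1) (coeff≈ P≋0 d))

  ∘ₚ≋0ₚ⇒deriv≋0ₚ : ∀ {M μ f} → deriv M ≋ constₚ μ → ¬ (μ ≈ 0#) → M ∘ₚ f ≋ 0ₚ → deriv f ≋ 0ₚ
  ∘ₚ≋0ₚ⇒deriv≋0ₚ {M} {μ} {f} M′≋μ μ≉0 Mf≋0 = [ (λ μ≋0 → ⊥-elim (μ≉0 (coeff≈ μ≋0 zero))) , id ]′
    (*ₚ-noZeroDivisors (constₚ μ) (deriv f) (≋-trans (≋-sym (deriv≋constₚ⇒deriv-∘ₚ {M} M′≋μ f)) (deriv-cong Mf≋0)))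

  -- Otherwise L′ = γ (A′ ∘ M) M′ would vanish, impossible for a separable L with a root.
  composite-inner-deriv≉0 : ∀ {L A M γ μ} → NiceQAdditive L → L ≋ γ ·ₚ (A ∘ₚ M) → deriv M ≋ constₚ μ → ¬ (μ ≈ 0#)
  composite-inner-deriv≉0 {L} {A} {M} {γ} (_ , L-separable , (d , 2<d , L-monic) , L-splits) L≋ M′≋μ μ≈0 =
    separable-root⇒deriv≉0 {L} L-separable (proj₂ (splits⇒root {L} L-splits L-monic 0<d)) (begin
      deriv L                            ≈⟨ deriv-cong L≋ ⟩
      deriv (γ ·ₚ (A ∘ₚ M))              ≈⟨ deriv-·ₚ γ (A ∘ₚ M) ⟩
      γ ·ₚ deriv (A ∘ₚ M)                ≈⟨ ·ₚ-cong refl (deriv-∘ₚ A M) ⟩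
      γ ·ₚ ((deriv A ∘ₚ M) *ₚ deriv M)   ≈⟨ ·ₚ-zeroʳ γ (≋-trans (*ₚ-congʳ A′∘M M′≋0) (*ₚ-zeroʳ A′∘M)) ⟩
      0ₚ                                 ∎)
    where
    open SetoidReasoning ≋-setoid
    0<d = ℕₚ.<-trans (s≤s z≤n) 2<d
    A′∘M = deriv A ∘ₚ M
    M′≋0 = ≋-trans M′≋μ (constₚ≋0ₚ μ≈0)

module PrimePowerField {c ℓ} (R : CommutativeRing c ℓ) (q n : ℕ) (F : IsFiniteFieldOfSize R (q ^ n))
                       {p k : ℕ} (p-prime : Prime p) (q≡p^ : q ≡ p ^ suc k) where
  open Poly R q n hiding (zero)
  open PolynomialRing R q n
  open FiniteField R F using (size×1≈0; ^ᴷ-≈0⇒≈0)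
  open PolynomialsOverFiniteField R q n F
  open SemiringMult semiring using (_×_; ×-congˡ; ×-congʳ; ×-assocˡ; ×-assoc-*; ×1-homo-*)
  open SemiringMultiples semiring using (×-zeroʳ)
  open SemiringExp semiring using () renaming (_^_ to _^ᴷ_; ^-congˡ to ^ᴷ-congˡ; ^-assocʳ to ^ᴷ-assocʳ)
  open CommutativeRing polynomialRing using ()
    renaming (semiring to polynomialSemiring; commutativeSemiring to polynomialCommutativeSemiring)
  open SemiringMult polynomialSemiring using () renaming (_×_ to _×ₚ_)
  module Pow = SemiringExp polynomialSemiring
  module CommPow = CommutativeSemiringExp polynomialCommutativeSemiring

  q^≡p^ : ∀ j → q ^ j ≡ p ^ (suc k ℕ.* j)
  q^≡p^ j = ≡.trans (≡.cong (_^ j) q≡p^) (ℕₚ.^-*-assoc p (suc k) j)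

  p×1≈0 : p × 1# ≈ 0#
  p×1≈0 = ^ᴷ-≈0⇒≈0 (suc k ℕ.* n) (begin
    (p × 1#) ^ᴷ (suc k ℕ.* n)   ≈⟨ p^×1 (suc k ℕ.* n) ⟨
    (p ^ (suc k ℕ.* n)) × 1#   ≈⟨ ×-congˡ (≡.sym (q^≡p^ n)) ⟩
    (q ^ n) × 1#               ≈⟨ size×1≈0 ⟩
    0#                         ∎)
    where
    open SetoidReasoning setoid
    p^×1 : ∀ m → (p ^ m) × 1# ≈ (p × 1#) ^ᴷ m
    p^×1 zero = +-identityʳ 1#
    p^×1 (suc m) = trans (×1-homo-* p (p ^ m)) (*-congˡ (p^×1 m))

  p×≈0 : ∀ x → p × x ≈ 0#
  p×≈0 x = trans (×-congʳ p (sym (*-identityˡ x))) (trans (sym (×-assoc-* p 1# x)) (trans (*-congʳ p×1≈0) (zeroˡ x)))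

  q^suc×≈0 : ∀ j x → (q ^ suc j) × x ≈ 0#
  q^suc×≈0 j x = begin
    (q ^ suc j) × x               ≈⟨ ×-congˡ (≡.trans (≡.cong (ℕ._* q ^ j) q≡p^) (ℕₚ.*-assoc p (p ^ k) (q ^ j))) ⟩
    (p ℕ.* (p ^ k ℕ.* q ^ j)) × x ≈⟨ ×-assocˡ x p _ ⟨
    p × ((p ^ k ℕ.* q ^ j) × x)   ≈⟨ p×≈0 _ ⟩
    0#                            ∎
    where open SetoidReasoning setoid

  coeff-×ₚ : ∀ m f i → coeff (m ×ₚ f) i ≈ m × coeff f i
  coeff-×ₚ zero f i = refl
  coeff-×ₚ (suc m) f i = trans (coeff-+ₚ f (m ×ₚ f) i) (+-congˡ (coeff-×ₚ m f i))

  frobeniusₚ-q^ : ∀ j f g → (f +ₚ g) ^ₚ (q ^ j) ≋ f ^ₚ (q ^ j) +ₚ g ^ₚ (q ^ j)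
  frobeniusₚ-q^ j f g rewrite q^≡p^ j = frobenius-p^ (suc k ℕ.* j) f g
    where
    frobeniusₚ : ∀ f g → (f +ₚ g) ^ₚ p ≋ f ^ₚ p +ₚ g ^ₚ p
    frobeniusₚ = Frobenius.frobenius polynomialCommutativeSemiring p-prime
                   (λ f → mk≋ λ i → trans (coeff-×ₚ p f i) (p×≈0 (coeff f i)))
    frobenius-p^ : ∀ m f g → (f +ₚ g) ^ₚ (p ^ m) ≋ f ^ₚ (p ^ m) +ₚ g ^ₚ (p ^ m)
    frobenius-p^ zero f g = *ₚ-distribʳ 1ₚ f g
    frobenius-p^ (suc m) f g = begin
      (f +ₚ g) ^ₚ (p ℕ.* p ^ m)           ≈⟨ Pow.^-assocʳ (f +ₚ g) p (p ^ m) ⟨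
      ((f +ₚ g) ^ₚ p) ^ₚ (p ^ m)          ≈⟨ Pow.^-congˡ (p ^ m) (frobeniusₚ f g) ⟩
      (f ^ₚ p +ₚ g ^ₚ p) ^ₚ (p ^ m)       ≈⟨ frobenius-p^ m (f ^ₚ p) (g ^ₚ p) ⟩
      (f ^ₚ p) ^ₚ (p ^ m) +ₚ (g ^ₚ p) ^ₚ (p ^ m)
        ≈⟨ +ₚ-cong (Pow.^-assocʳ f p (p ^ m)) (Pow.^-assocʳ g p (p ^ m)) ⟩
      f ^ₚ (p ℕ.* p ^ m) +ₚ g ^ₚ (p ℕ.* p ^ m) ∎
      where open SetoidReasoning ≋-setoid

  powK≡^ᴷ : ∀ a m → powK a m ≡ a ^ᴷ m
  powK≡^ᴷ a zero = ≡.refl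
  powK≡^ᴷ a (suc m) = ≡.cong (a *_) (powK≡^ᴷ a m)

  InFq⇒^q^≈ : ∀ {a} j → InFq a → a ^ᴷ (q ^ j) ≈ a
  InFq⇒^q^≈ zero _ = *-identityʳ _
  InFq⇒^q^≈ {a} (suc j) aᵠ≈a = begin
    a ^ᴷ (q ℕ.* q ^ j)    ≈⟨ ^ᴷ-assocʳ a q (q ^ j) ⟨
    (a ^ᴷ q) ^ᴷ (q ^ j)   ≈⟨ ^ᴷ-congˡ (q ^ j) (trans (reflexive (≡.sym (powK≡^ᴷ a q))) aᵠ≈a) ⟩
    a ^ᴷ (q ^ j)          ≈⟨ InFq⇒^q^≈ j aᵠ≈a ⟩
    a                     ∎
    where open SetoidReasoning setoid

  constₚ-^ₚ : ∀ a m → constₚ a ^ₚ m ≋ constₚ (a ^ᴷ m)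
  constₚ-^ₚ a zero = ≋-refl
  constₚ-^ₚ a (suc m) = ≋-trans (*ₚ-congʳ (constₚ a) (constₚ-^ₚ a m)) (≋-sym (constₚ-* a (a ^ᴷ m)))

  ·ₚ-^ₚ-q^ : ∀ {a} j f → InFq a → (a ·ₚ f) ^ₚ (q ^ j) ≋ constₚ a *ₚ f ^ₚ (q ^ j)
  ·ₚ-^ₚ-q^ {a} j f a∈Fq = begin
    (a ·ₚ f) ^ₚ (q ^ j)                ≈⟨ Pow.^-congˡ (q ^ j) (·ₚ≋constₚ*ₚ a f) ⟩
    (constₚ a *ₚ f) ^ₚ (q ^ j)         ≈⟨ CommPow.^-distrib-* (constₚ a) f (q ^ j) ⟩
    constₚ a ^ₚ (q ^ j) *ₚ f ^ₚ (q ^ j)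
      ≈⟨ *ₚ-congˡ _ (≋-trans (constₚ-^ₚ a (q ^ j)) (constₚ-cong (InFq⇒^q^≈ j a∈Fq))) ⟩
    constₚ a *ₚ f ^ₚ (q ^ j)           ∎
    where open SetoidReasoning ≋-setoid

  q^≢0 : ∀ j → q ^ j ≢ 0
  q^≢0 j q^≡0 = ℕ.≢-nonZero⁻¹ p {{prime⇒nonZero p-prime}}
    (ℕₚ.m^n≡0⇒m≡0 p (suc k) (≡.trans (≡.sym q≡p^) (ℕₚ.m^n≡0⇒m≡0 q j q^≡0)))

  coeff₀-qPolyFrom : ∀ j ω → coeff (qPolyFrom j ω) 0 ≈ 0#
  coeff₀-qPolyFrom j [] = refl
  coeff₀-qPolyFrom j (w ∷ ω) = begin
    coeff (w ·ₚ Xpow (q ^ j) +ₚ qPolyFrom (suc j) ω) 0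
      ≈⟨ coeff-+ₚ (w ·ₚ Xpow (q ^ j)) (qPolyFrom (suc j) ω) 0 ⟩
    coeff (w ·ₚ Xpow (q ^ j)) 0 + coeff (qPolyFrom (suc j) ω) 0
      ≈⟨ +-cong (trans (coeff-·ₚ w (Xpow (q ^ j)) 0) (*-congˡ (coeff-Xpow-≢ (q ^ j) (q^≢0 j ∘ ≡.sym))))
                (coeff₀-qPolyFrom (suc j) ω) ⟩
    w * 0# + 0#
      ≈⟨ trans (+-identityʳ _) (zeroʳ w) ⟩
    0# ∎
    where open SetoidReasoning setoid

  deriv-Xpow-q^suc : ∀ j → deriv (Xpow (q ^ suc j)) ≋ 0ₚ
  deriv-Xpow-q^suc j = mk≋ λ i → trans (coeff-deriv (Xpow Q) i) (vanishes i (suc i ℕ.≟ Q))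
    where
    Q = q ^ suc j
    vanishes : ∀ i → Dec (suc i ≡ Q) → suc i × coeff (Xpow Q) (suc i) ≈ 0#
    vanishes i (yes i+1≡Q) = trans (×-congˡ i+1≡Q) (q^suc×≈0 j _)
    vanishes i (no i+1≢Q) = trans (×-congʳ (suc i) (coeff-Xpow-≢ Q i+1≢Q)) (×-zeroʳ (suc i))

  deriv-qPolyFrom-suc : ∀ j ω → deriv (qPolyFrom (suc j) ω) ≋ 0ₚ
  deriv-qPolyFrom-suc j [] = ≋-refl
  deriv-qPolyFrom-suc j (w ∷ ω) = ≋-trans (deriv-+ₚ (w ·ₚ Xpow (q ^ suc j)) (qPolyFrom (suc (suc j)) ω))
    (+ₚ-cong (≋-trans (deriv-·ₚ w (Xpow (q ^ suc j))) (·ₚ-zeroʳ w (deriv-Xpow-q^suc j)))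
             (deriv-qPolyFrom-suc (suc j) ω))

  qAdditive⇒deriv-constant : ∀ {P} → IsQAdditive P → ∃ λ μ → deriv P ≋ constₚ μ
  qAdditive⇒deriv-constant {P} ([] , P≈0) = 0# , ≋-trans (deriv-cong (mk≋ {P} {[]} P≈0)) (≋-sym (constₚ≋0ₚ refl))
  qAdditive⇒deriv-constant {P} (w ∷ ω , P≈) = w , (begin
    deriv P                                            ≈⟨ deriv-cong (mk≋ {P} {qPolyFrom 0 (w ∷ ω)} P≈) ⟩
    deriv (w ·ₚ Xpow 1 +ₚ qPolyFrom 1 ω)               ≈⟨ deriv-+ₚ (w ·ₚ Xpow 1) (qPolyFrom 1 ω) ⟩
    deriv (w ·ₚ Xpow 1) +ₚ deriv (qPolyFrom 1 ω)       ≈⟨ +ₚ-cong (deriv-·ₚ w (Xpow 1)) (deriv-qPolyFrom-suc 0 ω) ⟩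
    w ·ₚ deriv (Xpow 1) +ₚ 0ₚ                          ≈⟨ +ₚ-identityʳ _ ⟩
    constₚ (w * (1# + 0#))
      ≈⟨ constₚ-cong (trans (*-congˡ (+-identityʳ 1#)) (*-identityʳ w)) ⟩
    constₚ w                                           ∎)
    where open SetoidReasoning ≋-setoid

  qAdditive-∘ₚ-0 : ∀ {P} → IsQAdditive P → P ∘ₚ constₚ 0# ≋ 0ₚ
  qAdditive-∘ₚ-0 {P} (ω , P≈) = ≋-trans (∘ₚ-constₚ P 0#)
    (constₚ≋0ₚ (trans (eval-0# P) (trans (P≈ 0) (coeff₀-qPolyFrom 0 ω))))

  monomial-∘ₚ : ∀ w m f → (w ·ₚ Xpow m) ∘ₚ f ≋ constₚ w *ₚ f ^ₚ m
  monomial-∘ₚ w m f = ≋-trans (·ₚ-∘ₚ w (Xpow m) f) (*ₚ-congʳ (constₚ w) (Xpow-∘ₚ m f))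

  qPolyFrom-∘ₚ-linear : ∀ {a b} j ω f g → InFq a → InFq b →
    qPolyFrom j ω ∘ₚ (a ·ₚ f +ₚ b ·ₚ g) ≋ a ·ₚ (qPolyFrom j ω ∘ₚ f) +ₚ b ·ₚ (qPolyFrom j ω ∘ₚ g)
  qPolyFrom-∘ₚ-linear j [] f g _ _ = ≋-refl
  qPolyFrom-∘ₚ-linear {a} {b} j (w ∷ ω) f g a∈Fq b∈Fq = begin
    (w ·ₚ Xpow Q +ₚ P) ∘ₚ h
      ≈⟨ +ₚ-∘ₚ (w ·ₚ Xpow Q) P h ⟩
    (w ·ₚ Xpow Q) ∘ₚ h +ₚ P ∘ₚ h
      ≈⟨ +ₚ-cong (≋-trans (monomial-∘ₚ w Q h) (*ₚ-congʳ Ω h^Q≋))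
                 (≋-trans (qPolyFrom-∘ₚ-linear (suc j) ω f g a∈Fq b∈Fq)
                          (+ₚ-cong (·ₚ≋constₚ*ₚ a (P ∘ₚ f)) (·ₚ≋constₚ*ₚ b (P ∘ₚ g)))) ⟩
    Ω *ₚ (A *ₚ f ^ₚ Q +ₚ B *ₚ g ^ₚ Q) +ₚ (A *ₚ (P ∘ₚ f) +ₚ B *ₚ (P ∘ₚ g))
      ≈⟨ solve 7 (λ W A B F G PF PG → W :* (A :* F :+ B :* G) :+ (A :* PF :+ B :* PG)
                                      := A :* (W :* F :+ PF) :+ B :* (W :* G :+ PG))
           ≋-refl Ω A B (f ^ₚ Q) (g ^ₚ Q) (P ∘ₚ f) (P ∘ₚ g) ⟩
    A *ₚ (Ω *ₚ f ^ₚ Q +ₚ P ∘ₚ f) +ₚ B *ₚ (Ω *ₚ g ^ₚ Q +ₚ P ∘ₚ g)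
      ≈⟨ +ₚ-cong (≋-trans (*ₚ-congʳ A (≋-sym (term-∘ₚ f))) (≋-sym (·ₚ≋constₚ*ₚ a _)))
                 (≋-trans (*ₚ-congʳ B (≋-sym (term-∘ₚ g))) (≋-sym (·ₚ≋constₚ*ₚ b _))) ⟩
    a ·ₚ ((w ·ₚ Xpow Q +ₚ P) ∘ₚ f) +ₚ b ·ₚ ((w ·ₚ Xpow Q +ₚ P) ∘ₚ g) ∎
    where
    open SetoidReasoning ≋-setoid
    open Polynomial using (solve; _:+_; _:*_; _:=_)
    Q = q ^ j
    P = qPolyFrom (suc j) ω
    h = a ·ₚ f +ₚ b ·ₚ g
    Ω = constₚ w
    A = constₚ a
    B = constₚ b
    h^Q≋ : h ^ₚ Q ≋ A *ₚ f ^ₚ Q +ₚ B *ₚ g ^ₚ Q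
    h^Q≋ = ≋-trans (frobeniusₚ-q^ j (a ·ₚ f) (b ·ₚ g)) (+ₚ-cong (·ₚ-^ₚ-q^ j f a∈Fq) (·ₚ-^ₚ-q^ j g b∈Fq))
    term-∘ₚ : ∀ t → (w ·ₚ Xpow Q +ₚ P) ∘ₚ t ≋ Ω *ₚ t ^ₚ Q +ₚ P ∘ₚ t
    term-∘ₚ t = ≋-trans (+ₚ-∘ₚ (w ·ₚ Xpow Q) P t) (+ₚ-cong (monomial-∘ₚ w Q t) (≋-refl {P ∘ₚ t}))

  qAdditive-∘ₚ-linear : ∀ {P a b} → IsQAdditive P → InFq a → InFq b → ∀ f g →
    P ∘ₚ (a ·ₚ f +ₚ b ·ₚ g) ≋ a ·ₚ (P ∘ₚ f) +ₚ b ·ₚ (P ∘ₚ g)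
  qAdditive-∘ₚ-linear {P} {a} {b} (ω , P≈) a∈Fq b∈Fq f g = begin
    P ∘ₚ (a ·ₚ f +ₚ b ·ₚ g)                          ≈⟨ ∘ₚ-congˡ _ P≋ ⟩
    qPolyFrom 0 ω ∘ₚ (a ·ₚ f +ₚ b ·ₚ g)              ≈⟨ qPolyFrom-∘ₚ-linear 0 ω f g a∈Fq b∈Fq ⟩
    a ·ₚ (qPolyFrom 0 ω ∘ₚ f) +ₚ b ·ₚ (qPolyFrom 0 ω ∘ₚ g)
      ≈⟨ +ₚ-cong (·ₚ-cong refl (∘ₚ-congˡ f (≋-sym P≋))) (·ₚ-cong refl (∘ₚ-congˡ g (≋-sym P≋))) ⟩
    a ·ₚ (P ∘ₚ f) +ₚ b ·ₚ (P ∘ₚ g)                   ∎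
    where
    open SetoidReasoning ≋-setoid
    P≋ : P ≋ qPolyFrom 0 ω
    P≋ = mk≋ P≈

  W-of-kernel : ∀ {A L M γ f} → IsQAdditive A → L ≋ γ ·ₚ (A ∘ₚ M) → M ∘ₚ f ≋ 0ₚ → deriv f ≋ 0ₚ → W L f
  W-of-kernel {A} {L} {M} {γ} {f} A-additive L≋ Mf≋0 f′≋0 = root⇒W {L} {f} (begin
    L ∘ₚ f                              ≈⟨ ∘ₚ-congˡ f L≋ ⟩
    (γ ·ₚ (A ∘ₚ M)) ∘ₚ f                ≈⟨ ·ₚ-∘ₚ-assoc γ A M f ⟩
    constₚ γ *ₚ (A ∘ₚ (M ∘ₚ f))         ≈⟨ *ₚ-congʳ (constₚ γ) (∘ₚ-congʳ A (≋-trans Mf≋0 (≋-sym (constₚ≋0ₚ refl)))) ⟩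
    constₚ γ *ₚ (A ∘ₚ constₚ 0#)        ≈⟨ *ₚ-congʳ (constₚ γ) (qAdditive-∘ₚ-0 {A} A-additive) ⟩
    constₚ γ *ₚ 0ₚ                      ≈⟨ *ₚ-zeroʳ (constₚ γ) ⟩
    0ₚ                                  ∎) f′≋0
    where open SetoidReasoning ≋-setoid

  module Composition {A L M γ} (L-nice : NiceQAdditive L) (M-additive : IsQAdditive M)
                     (L≋ : L ≋ γ ·ₚ (A ∘ₚ M)) where
    private
      μ = proj₁ (qAdditive⇒deriv-constant {M} M-additive)
      M′≋μ : deriv M ≋ constₚ μ
      M′≋μ = proj₂ (qAdditive⇒deriv-constant {M} M-additive)
      μ≉0 : ¬ (μ ≈ 0#)
      μ≉0 = composite-inner-deriv≉0 {L} {A} {M} L-nice L≋ M′≋μ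

    W-∘ₚ : ¬ (γ ≈ 0#) → ∀ {f} → W L f → W A (M ∘ₚ f)
    W-∘ₚ γ≉0 {f} = W-transfer {L} {A} {f} γ≉0 μ≉0 (≋-trans (∘ₚ-congˡ f L≋) (·ₚ-∘ₚ-assoc γ A M f))
                     (deriv≋constₚ⇒deriv-∘ₚ {M} M′≋μ f)

    W-kernel⇒constant : ∀ {f} → W L f → M ∘ₚ f ≋ 0ₚ → ∃ λ r → f ≋ constₚ r
    W-kernel⇒constant {f} f∈W Mf≋0 =
      splits-∘ₚ≋0ₚ⇒constant {L} f L-splits (monic⇒≉0ₚ {L} L-monic)
        (W⇒root {L} f∈W (∘ₚ≋0ₚ⇒deriv≋0ₚ {M} M′≋μ μ≉0 Mf≋0))
      where
      L-monic = proj₂ (proj₂ (proj₁ (proj₂ (proj₂ L-nice))))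
      L-splits = proj₂ (proj₂ (proj₂ L-nice))

-- Imported only here: above, _×_ is the ℕ-action of Algebra.Properties.Semiring.Mult.
open import Data.Product using (_×_)

lemma5p1 : ∀ {c ℓ : Level} (R : CommutativeRing c ℓ) (q n : ℕ) → PrimePower q → 1 ≤ n
    → IsFiniteFieldOfSize R (q ^ n)
    → let open Poly R q n in
      (A L M : Pol) → NiceQAdditive A → NiceQAdditive L → IsQAdditive M
    → (∃ λ γ → ¬ (γ ≈ 0#) × (L ≈ₚ γ ·ₚ (A ∘ₚ M)))
    → (∀ F → W L F → W A (M ∘ₚ F))
      × (∀ a b F G → InFq a → InFq b → W L F → W L G
           → M ∘ₚ ((a ·ₚ F) +ₚ (b ·ₚ G)) ≈ₚ (a ·ₚ (M ∘ₚ F)) +ₚ (b ·ₚ (M ∘ₚ G)))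
      × (∀ F → (W L F × (M ∘ₚ F ≈ₚ 0ₚ)) ⇔ (∃ λ r → eval M r ≈ 0# × F ≈ₚ constₚ r))
lemma5p1 R q n (p , k , p-prime , q≡p^) _ 𝔽 A L M (A-additive , _) L-nice M-additive (γ , γ≉0 , L≈) =
  (λ f → W-∘ₚ γ≉0)
  , (λ a b f g a∈Fq b∈Fq _ _ → coeff≈ (qAdditive-∘ₚ-linear {M} M-additive a∈Fq b∈Fq f g))
  , λ f → mk⇔ (kernel⇒root f) (root⇒kernel f)
  where
  open Poly R q n hiding (zero)
  open PolynomialRing R q n
  open PrimePowerField R q n 𝔽 {k = k} p-prime q≡p^
  L≋ : L ≋ γ ·ₚ (A ∘ₚ M)
  L≋ = mk≋ L≈
  open Composition {A} {L} {M} {γ} L-nice M-additive L≋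
  kernel⇒root : ∀ f → W L f × (M ∘ₚ f ≈ₚ 0ₚ) → ∃ λ r → eval M r ≈ 0# × f ≈ₚ constₚ r
  kernel⇒root f (f∈W , Mf≈0) = let (r , f≋r) = W-kernel⇒constant f∈W Mf≋0 in
    r , ∘ₚ≋0ₚ⇒root M f≋r Mf≋0 , coeff≈ f≋r
    where
    Mf≋0 : M ∘ₚ f ≋ 0ₚ
    Mf≋0 = mk≋ Mf≈0
  root⇒kernel : ∀ f → (∃ λ r → eval M r ≈ 0# × f ≈ₚ constₚ r) → W L f × (M ∘ₚ f ≈ₚ 0ₚ)
  root⇒kernel f (r , Mr≈0 , f≈r) = W-of-kernel {A} A-additive L≋ Mf≋0 (deriv-cong f≋r) , coeff≈ Mf≋0
    where
    f≋r : f ≋ constₚ r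
    f≋r = mk≋ f≈r
    Mf≋0 : M ∘ₚ f ≋ 0ₚ
    Mf≋0 = ∘ₚ-root M Mr≈0 f≋r
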